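{- Let $J_1, J_2, \ldots, J_k$ and $J'_1, J'_2, \ldots, J'_l$ be graphs. Then there is a finite set $\mathcal{J}$ of graphs without isolated vertices, and polynomials $m_J(n)$ (one for each $J\in\mathcal{J}$, with real coefficients, not depending on $G$) such that \[ |V(J)| + \deg m_J(n) \leq 1+\sum_{i=1}^k |V(J_i)| + \sum_{j=1}^l |V(J'_j)| \] for every $J\in\mathcal J$, and \[ \sum_{v\in V(G)} \prod_{i=1}^k s(J_i,G^-_v) \prod_{j=1}^l s(J'_j,G^+_v) = \sum_{J\in \mathcal{J}} m_J(n)\,j(J,G) \] for every graph $G$, where $n=|V(G)|$.
   Context: All graphs are finite and simple. For graphs $J,G$, $s(J,G)$ denotes the number of induced subgraphs of $G$ isomorphic to $J$. For a vertex $v$ of $G$, $G^+_v$ is the subgraph of $G$ induced by the vertices adjacent to $v$, and $G^-_v$ is the subgraph of $G$ induced by the vertices different from $v$ and not adjacent to $v$. For graphs $J$ and $G$, \[ j(J,G)=\sum_{\phi} (-1)^{|\{uv\in E(J)\,:\, \phi(u)\phi(v)\notin E(G)\}|}, \] where $\phi$ ranges over all injective maps $V(J)\to V(G)$. -}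

module Defs where

open import Data.Bool using (Bool; true; false; _∧_; _∨_; not; if_then_else_)
open import Data.Nat as ℕ using (ℕ; zero; suc; _≤_)
open import Data.Integer as ℤ using (ℤ; +_)
open import Data.Rational as ℚ using (ℚ; 0ℚ)
open import Data.Fin using (Fin)
open import Data.Fin.Properties using (_≟_)
open import Data.Vec using (Vec; []; _∷_; lookup)
open import Data.List as L using (List; []; _∷_; length; map; concatMap; filterᵇ; allFin; foldr)
open import Data.List.Properties using (length-map)
open import Data.Product using (∃-syntax; _×_; _,_)
open import Relation.Nullary.Decidable using (⌊_⌋)
open import Relation.Binary.PropositionalEquality using (_≡_; _≢_)

record Graph : Set where
  field
    size   : ℕ
    adj    : Fin size → Fin size → Bool
    sym    : ∀ u v → adj u v ≡ adj v u
    irrefl : ∀ v → adj v v ≡ false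
open Graph public

_==_ : ∀ {n} → Fin n → Fin n → Bool
i == j = ⌊ i ≟ j ⌋

allVecs : {A : Set} → List A → (k : ℕ) → List (Vec A k)
allVecs xs zero    = [] ∷ []
allVecs xs (suc k) = concatMap (λ x → map (x ∷_) (allVecs xs k)) xs

anyᵇ : {A : Set} → (A → Bool) → List A → Bool
anyᵇ p = foldr (λ x b → p x ∨ b) false

allᵇ : {A : Set} → (A → Bool) → List A → Bool
allᵇ p = foldr (λ x b → p x ∧ b) true

countᵇ : {A : Set} → (A → Bool) → List A → ℕ
countᵇ p xs = length (filterᵇ p xs)

-- All maps V(J) → V(G), represented as vectors of images.
maps : (J G : Graph) → List (Vec (Fin (size G)) (size J))
maps J G = allVecs (allFin (size G)) (size J)

isInjective : ∀ {k n} → Vec (Fin n) k → Bool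
isInjective {k} φ =
  allᵇ (λ u → allᵇ (λ v → (u == v) ∨ not (lookup φ u == lookup φ v)) (allFin k)) (allFin k)

injMaps : (J G : Graph) → List (Vec (Fin (size G)) (size J))
injMaps J G = filterᵇ isInjective (maps J G)

isInduced : (J G : Graph) → Vec (Fin (size G)) (size J) → Bool
isInduced J G φ =
  allᵇ (λ u → allᵇ (λ v → ⌊ Data.Bool._≟_ (adj J u v) (adj G (lookup φ u) (lookup φ v)) ⌋)
                     (allFin (size J))) (allFin (size J))
  where import Data.Bool

-- image of φ equals the vertex subset S
hasImage : ∀ {k n} → Vec (Fin n) k → Vec Bool n → Bool
hasImage {k} {n} φ S =
  allᵇ (λ w → ⌊ Data.Bool._≟_ (lookup S w) (anyᵇ (λ i → lookup φ i == w) (allFin k)) ⌋) (allFin n)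
  where import Data.Bool

-- The induced subgraph G[S] is isomorphic to J: there is an injective map
-- V(J) → V(G) with image S preserving adjacency and non-adjacency.
inducedIso : (J G : Graph) → Vec Bool (size G) → Bool
inducedIso J G S = anyᵇ (λ φ → hasImage φ S ∧ isInduced J G φ) (injMaps J G)

s : Graph → Graph → ℕ
s J G = countᵇ (inducedIso J G) (allVecs (true ∷ false ∷ []) (size G))

sign : ℕ → ℤ
sign zero    = + 1
sign (suc m) = ℤ.- sign m

-- number of edges uv of J (counted once, u < v) mapped to non-edges of G
brokenEdges : (J G : Graph) → Vec (Fin (size G)) (size J) → ℕ
brokenEdges J G φ =
  countᵇ (λ uv → adj J (Data.Product.proj₁ uv) (Data.Product.proj₂ uv)
                 ∧ ⌊ Data.Fin._<?_ (Data.Product.proj₁ uv) (Data.Product.proj₂ uv) ⌋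
                 ∧ not (adj G (lookup φ (Data.Product.proj₁ uv)) (lookup φ (Data.Product.proj₂ uv))))
         (L.cartesianProduct (allFin (size J)) (allFin (size J)))
  where import Data.Product; import Data.Fin

sumℤ : List ℤ → ℤ
sumℤ = foldr ℤ._+_ (+ 0)

j : Graph → Graph → ℤ
j J G = sumℤ (map (λ φ → sign (brokenEdges J G φ)) (injMaps J G))

induced : (G : Graph) → (Fin (size G) → Bool) → Graph
induced G p = record
  { size   = length vs
  ; adj    = λ a b → adj G (L.lookup vs a) (L.lookup vs b)
  ; sym    = λ a b → sym G (L.lookup vs a) (L.lookup vs b)
  ; irrefl = λ a → irrefl G (L.lookup vs a)
  }
  where vs = filterᵇ p (allFin (size G))

G⁺ : (G : Graph) → Fin (size G) → Graph
G⁺ G v = induced G (λ w → adj G v w)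

G⁻ : (G : Graph) → Fin (size G) → Graph
G⁻ G v = induced G (λ w → not (w == v) ∧ not (adj G v w))

NoIsolatedVertices : Graph → Set
NoIsolatedVertices J = ∀ v → ∃[ u ] (adj J v u ≡ true)

-- Polynomials in one variable with rational coefficients, as coefficient
-- lists [a₀, a₁, …] (lowest degree first).
Poly : Set
Poly = List ℚ

coeff : Poly → ℕ → ℚ
coeff []       _       = 0ℚ
coeff (a ∷ p)  zero    = a
coeff (a ∷ p)  (suc i) = coeff p i

evalPoly : Poly → ℕ → ℚ
evalPoly []      x = 0ℚ
evalPoly (a ∷ p) x = a ℚ.+ ((+ x) ℚ./ 1) ℚ.* evalPoly p x

-- "c + deg m ≤ b": every nonzero coefficient a_i of m has c + i ≤ b
-- (vacuous for the zero polynomial, whose degree is -∞).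
DegBound : ℕ → Poly → ℕ → Set
DegBound c m b = ∀ i → coeff m i ≢ 0ℚ → c ℕ.+ i ≤ b

prodℕ : List ℕ → ℕ
prodℕ = foldr ℕ._*_ 1

sumℕ : List ℕ → ℕ
sumℕ = foldr ℕ._+_ 0

sumℚ : List ℚ → ℚ
sumℚ = foldr ℚ._+_ 0ℚ

lhs : List Graph → List Graph → Graph → ℕ
lhs Js Js' G =
  sumℕ (map (λ v → prodℕ (map (λ J → s J (G⁻ G v)) Js) ℕ.* prodℕ (map (λ J' → s J' (G⁺ G v)) Js'))
            (allFin (size G)))

rhs : List (Graph × Poly) → Graph → ℚ
rhs 𝒥 G = sumℚ (map (λ { (J , m) → evalPoly m (size G) ℚ.* (j J G ℚ./ 1) }) 𝒥)

toℚ : ℕ → ℚ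
toℚ k = (+ k) ℚ./ 1

module Submission where

-- After multiplying by the nonzero constant Π|V(J_i)|! Π|V(J'_j)|!, each
-- s(J, G^±_v)·|V(J)|! counts distinct tuples on one side of v whose adjacency pattern
-- is a copy of J, so the left-hand side becomes a sum, over all r-tuples of vertices,
-- of a function of the equality and adjacency patterns of the tuple (a pattern
-- function).  Every such tuple sum is expressible with bound r:
--   * grouping coincident entries reduces it to sums over injective tuples of fewer
--     entries (disjointSum-expressible);
--   * over injective tuples, the Fourier expansion of the pattern in the ±1 edge
--     signs reduces it to signed counts Σ_φ Π_{uv ∈ E(H)} (±1) (injectiveSum-expressible);
--   * a signed count is j(H,G) when H has no isolated vertex, and an isolated vertex
--     contributes a linear factor (n - c), trading one vertex for one degree
--     (signedCount-expressible).

module Proof where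

  open import Defs hiding (sym)
  open import Data.Bool using (Bool; true; false; _∧_; _∨_; not; if_then_else_) renaming (_≟_ to _≟ᵇ_)
  open import Data.Bool.Properties using (∧-conicalˡ; ∧-conicalʳ; ∧-zeroʳ; ∧-identityʳ)
  open import Data.Nat as ℕ using (ℕ; zero; suc; _≤_; _!)
  import Data.Nat.Properties as ℕP
  import Data.Nat.Coprimality as Coprimality
  open Coprimality using (Coprime; 1-coprimeTo)
  open import Data.Integer as ℤ using (ℤ; -[1+_])
  import Data.Integer.Properties as ℤP
  open import Data.Rational as ℚ using (ℚ; mkℚ; 0ℚ; 1ℚ; ½; _+_; _*_; -_; _-_; _/_)
  open import Data.Rational.Properties as ℚP using (+-identityˡ; +-identityʳ; *-identityˡ; *-identityʳ; *-zeroˡ; *-zeroʳ; +-comm; *-comm; +-assoc; *-assoc; *-distribˡ-+)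
  open import Data.Rational.Solver
  open import Data.Fin as F using (Fin; zero; suc; punchIn; _<?_; _↑ˡ_; _↑ʳ_)
  import Data.Fin.Properties as FP
  open import Data.Vec as V using (Vec; []; _∷_; lookup; _++_; tabulate)
  import Data.Vec.Properties as VP
  open import Data.List as L using (List; []; _∷_; map; concatMap; filterᵇ; allFin; foldr; length; cartesianProduct)
  import Data.List.Properties as LP
  open import Data.List.Relation.Unary.All as All using (All; []; _∷_)
  import Data.List.Relation.Unary.All.Properties as AllP
  open import Data.Product using (_×_; _,_; proj₁; proj₂; Σ; ∃; ∃-syntax)
  open import Data.Sum using (_⊎_; inj₁; inj₂)
  open import Data.List.Relation.Unary.Unique.Propositional using (Unique)
  open import Data.List.Relation.Unary.AllPairs using ([]; _∷_)
  import Data.List.Relation.Unary.Unique.Propositional.Properties as Unique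
  open import Data.List.Membership.Propositional.Properties using (∈-lookup)
  open import Data.Empty using (⊥-elim)
  open import Function using (_∘_; id)
  open import Relation.Nullary using (Dec; yes; no; ¬_)
  open import Relation.Nullary.Decidable using (⌊_⌋; T?)
  open import Relation.Binary.Definitions using (tri<; tri≈; tri>)
  open import Relation.Binary.PropositionalEquality hiding ([_])
  open ≡-Reasoning
  open +-*-Solver

  ∑ : {A : Set} → List A → (A → ℚ) → ℚ
  ∑ xs f = sumℚ (map f xs)

  ∏ : {A : Set} → List A → (A → ℚ) → ℚ
  ∏ xs f = foldr (λ x acc → f x * acc) 1ℚ xs

  [_] : Bool → ℚ
  [ b ] = if b then 1ℚ else 0ℚ

  module _ {A : Set} where
    ∑-cong : (xs : List A) {f g : A → ℚ} → (∀ x → f x ≡ g x) → ∑ xs f ≡ ∑ xs g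
    ∑-cong [] e = refl
    ∑-cong (x ∷ xs) e = cong₂ _+_ (e x) (∑-cong xs e)

    ∏-cong : (xs : List A) {f g : A → ℚ} → (∀ x → f x ≡ g x) → ∏ xs f ≡ ∏ xs g
    ∏-cong [] e = refl
    ∏-cong (x ∷ xs) e = cong₂ _*_ (e x) (∏-cong xs e)

    ∑-++ : (xs ys : List A) (f : A → ℚ) → ∑ (xs L.++ ys) f ≡ ∑ xs f + ∑ ys f
    ∑-++ [] ys f = sym (+-identityˡ _)
    ∑-++ (x ∷ xs) ys f = trans (cong (f x +_) (∑-++ xs ys f)) (sym (+-assoc (f x) _ _))

    ∑-+ : (xs : List A) (f g : A → ℚ) → ∑ xs (λ x → f x + g x) ≡ ∑ xs f + ∑ xs g
    ∑-+ [] f g = refl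
    ∑-+ (x ∷ xs) f g = trans (cong (f x + g x +_) (∑-+ xs f g))
      (solve 4 (λ a b c d → (a :+ b) :+ (c :+ d) := (a :+ c) :+ (b :+ d)) refl (f x) (g x) (∑ xs f) (∑ xs g))

    ∑-*ˡ : (xs : List A) (c : ℚ) (f : A → ℚ) → c * ∑ xs f ≡ ∑ xs (λ x → c * f x)
    ∑-*ˡ [] c f = *-zeroʳ c
    ∑-*ˡ (x ∷ xs) c f = trans (*-distribˡ-+ c (f x) _) (cong (c * f x +_) (∑-*ˡ xs c f))

    ∑-*ʳ : (xs : List A) (c : ℚ) (f : A → ℚ) → ∑ xs f * c ≡ ∑ xs (λ x → f x * c)
    ∑-*ʳ xs c f = trans (*-comm _ c) (trans (∑-*ˡ xs c f) (∑-cong xs (λ x → *-comm c (f x))))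

    ∑-zeros : (xs : List A) → ∑ xs (λ _ → 0ℚ) ≡ 0ℚ
    ∑-zeros [] = refl
    ∑-zeros (x ∷ xs) = trans (+-identityˡ _) (∑-zeros xs)

    ∑-vanish : (xs : List A) (f : A → ℚ) → (∀ x → f x ≡ 0ℚ) → ∑ xs f ≡ 0ℚ
    ∑-vanish xs f e = trans (∑-cong xs e) (∑-zeros xs)

    ∑-neg : (xs : List A) (f : A → ℚ) → ∑ xs (λ x → - f x) ≡ - ∑ xs f
    ∑-neg [] f = refl
    ∑-neg (x ∷ xs) f = trans (cong (- f x +_) (∑-neg xs f)) (sym (ℚP.neg-distrib-+ (f x) _))

    ∑-filter : (p : A → Bool) (xs : List A) (f : A → ℚ) → ∑ (filterᵇ p xs) f ≡ ∑ xs (λ x → [ p x ] * f x)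
    ∑-filter p [] f = refl
    ∑-filter p (x ∷ xs) f with p x
    ... | true = cong₂ _+_ (sym (*-identityˡ (f x))) (∑-filter p xs f)
    ... | false = trans (∑-filter p xs f) (trans (sym (+-identityˡ _)) (cong (_+ _) (sym (*-zeroˡ (f x)))))

    ∏-* : (xs : List A) (f g : A → ℚ) → ∏ xs (λ x → f x * g x) ≡ ∏ xs f * ∏ xs g
    ∏-* [] f g = refl
    ∏-* (x ∷ xs) f g = trans (cong (f x * g x *_) (∏-* xs f g))
      (solve 4 (λ a b c d → (a :* b) :* (c :* d) := (a :* c) :* (b :* d)) refl (f x) (g x) (∏ xs f) (∏ xs g))

    ∏-1 : (xs : List A) (f : A → ℚ) → (∀ x → f x ≡ 1ℚ) → ∏ xs f ≡ 1ℚ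
    ∏-1 [] f e = refl
    ∏-1 (x ∷ xs) f e = trans (cong₂ _*_ (e x) (∏-1 xs f e)) refl

  module _ {A B : Set} where
    ∑-map : (g : A → B) (xs : List A) (f : B → ℚ) → ∑ (map g xs) f ≡ ∑ xs (f ∘ g)
    ∑-map g [] f = refl
    ∑-map g (x ∷ xs) f = cong (f (g x) +_) (∑-map g xs f)

    ∏-map : (g : A → B) (xs : List A) (f : B → ℚ) → ∏ (map g xs) f ≡ ∏ xs (f ∘ g)
    ∏-map g [] f = refl
    ∏-map g (x ∷ xs) f = cong (f (g x) *_) (∏-map g xs f)

    ∑-concatMap : (g : A → List B) (xs : List A) (f : B → ℚ) → ∑ (concatMap g xs) f ≡ ∑ xs (λ x → ∑ (g x) f)
    ∑-concatMap g [] f = refl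
    ∑-concatMap g (x ∷ xs) f = trans (∑-++ (g x) (concatMap g xs) f) (cong (∑ (g x) f +_) (∑-concatMap g xs f))

    ∑-swap : (xs : List A) (ys : List B) (f : A → B → ℚ) →
      ∑ xs (λ x → ∑ ys (λ y → f x y)) ≡ ∑ ys (λ y → ∑ xs (λ x → f x y))
    ∑-swap [] ys f = sym (∑-zeros ys)
    ∑-swap (x ∷ xs) ys f = trans (cong (∑ ys (f x) +_) (∑-swap xs ys f)) (sym (∑-+ ys (f x) _))

  allFin-suc : ∀ n → allFin (suc n) ≡ zero ∷ map suc (allFin n)
  allFin-suc n = cong (zero ∷_) (sym (LP.map-tabulate id suc))

  ∑-allFin-suc : ∀ n (f : Fin (suc n) → ℚ) → ∑ (allFin (suc n)) f ≡ f zero + ∑ (allFin n) (f ∘ suc)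
  ∑-allFin-suc n f = trans (cong (λ l → ∑ l f) (allFin-suc n)) (cong (f zero +_) (∑-map suc (allFin n) f))

  ∏-allFin-suc : ∀ n (f : Fin (suc n) → ℚ) → ∏ (allFin (suc n)) f ≡ f zero * ∏ (allFin n) (f ∘ suc)
  ∏-allFin-suc n f = trans (cong (λ l → ∏ l f) (allFin-suc n)) (cong (f zero *_) (∏-map suc (allFin n) f))

  ∏-allFin-punchIn : ∀ n (i : Fin (suc n)) (f : Fin (suc n) → ℚ) → ∏ (allFin (suc n)) f ≡ f i * ∏ (allFin n) (f ∘ punchIn i)
  ∏-allFin-punchIn n zero f = ∏-allFin-suc n f
  ∏-allFin-punchIn (suc n) (suc i) f = begin
    ∏ (allFin (suc (suc n))) f ≡⟨ ∏-allFin-suc (suc n) f ⟩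
    f zero * ∏ (allFin (suc n)) (f ∘ suc) ≡⟨ cong (f zero *_) (∏-allFin-punchIn n i (f ∘ suc)) ⟩
    f zero * (f (suc i) * ∏ (allFin n) (f ∘ suc ∘ punchIn i)) ≡⟨ solve 3 (λ a b c → a :* (b :* c) := b :* (a :* c)) refl (f zero) (f (suc i)) _ ⟩
    f (suc i) * (f zero * ∏ (allFin n) (f ∘ suc ∘ punchIn i)) ≡⟨ cong (f (suc i) *_) (sym (∏-allFin-suc n (f ∘ punchIn (suc i)))) ⟩
    f (suc i) * ∏ (allFin (suc n)) (f ∘ punchIn (suc i)) ∎

  [∧] : ∀ x y → [ x ∧ y ] ≡ [ x ] * [ y ]
  [∧] true y = sym (*-identityˡ [ y ])
  [∧] false y = sym (*-zeroˡ [ y ])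

  [not] : ∀ x → [ not x ] ≡ 1ℚ - [ x ]
  [not] true = refl
  [not] false = refl

  [∨] : ∀ x y → [ x ∨ y ] ≡ [ x ] + [ not x ] * [ y ]
  [∨] true y = sym (trans (cong (1ℚ +_) (*-zeroˡ [ y ])) (+-identityʳ 1ℚ))
  [∨] false y = sym (trans (+-identityˡ _) (*-identityˡ [ y ]))

  split-by : ∀ x (q : ℚ) → q ≡ [ x ] * q + [ not x ] * q
  split-by true q = solve 1 (λ q → q := con 1ℚ :* q :+ con 0ℚ :* q) refl q
  split-by false q = solve 1 (λ q → q := con 0ℚ :* q :+ con 1ℚ :* q) refl q

  ==-refl : ∀ {n} (i : Fin n) → (i == i) ≡ true
  ==-refl i with i FP.≟ i
  ... | yes _ = refl
  ... | no ¬p = ⊥-elim (¬p refl)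

  ==-true : ∀ {n} {i j : Fin n} → (i == j) ≡ true → i ≡ j
  ==-true {i = i} {j} e with i FP.≟ j
  ... | yes p = p
  ==-true {i = i} {j} () | no _

  ==-false : ∀ {n} {i j : Fin n} → i ≢ j → (i == j) ≡ false
  ==-false {i = i} {j} ne with i FP.≟ j
  ... | yes p = ⊥-elim (ne p)
  ... | no _ = refl

  ==-sym : ∀ {n} (i j : Fin n) → (i == j) ≡ (j == i)
  ==-sym i j with i FP.≟ j | j FP.≟ i
  ... | yes _ | yes _ = refl
  ... | no _ | no _ = refl
  ... | yes p | no q = ⊥-elim (q (sym p))
  ... | no p | yes q = ⊥-elim (p (sym q))

  ==-suc : ∀ {n} (i j : Fin n) → (suc i == suc j) ≡ (i == j)
  ==-suc i j with i FP.≟ j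
  ... | yes _ = refl
  ... | no _ = refl

  ∑-delta : ∀ n (a : Fin n) (f : Fin n → ℚ) → ∑ (allFin n) (λ w → [ a == w ] * f w) ≡ f a
  ∑-delta (suc n) zero f = begin
    ∑ (allFin (suc n)) (λ w → [ zero == w ] * f w) ≡⟨ ∑-allFin-suc n (λ w → [ zero == w ] * f w) ⟩
    [ zero {n} == zero ] * f zero + ∑ (allFin n) (λ w → [ zero == suc w ] * f (suc w))
      ≡⟨ cong₂ _+_ (cong (λ b → [ b ] * f zero) (==-refl {suc n} zero))
           (∑-vanish (allFin n) _ (λ w → trans (cong (λ b → [ b ] * f (suc w)) (==-false {suc n} {zero} {suc w} (λ ())))
             (*-zeroˡ (f (suc w))))) ⟩
    1ℚ * f zero + 0ℚ ≡⟨ trans (+-identityʳ (1ℚ * f zero)) (*-identityˡ (f zero)) ⟩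
    f zero ∎
  ∑-delta (suc n) (suc a) f = begin
    ∑ (allFin (suc n)) (λ w → [ suc a == w ] * f w) ≡⟨ ∑-allFin-suc n (λ w → [ suc a == w ] * f w) ⟩
    [ suc a == zero ] * f zero + ∑ (allFin n) (λ w → [ suc a == suc w ] * f (suc w))
      ≡⟨ cong₂ _+_ (trans (cong (λ b → [ b ] * f zero) (==-false {suc n} {suc a} {zero} (λ ()))) (*-zeroˡ (f zero)))
                   (∑-cong (allFin n) (λ w → cong (λ b → [ b ] * f (suc w)) (==-suc a w))) ⟩
    0ℚ + ∑ (allFin n) (λ w → [ a == w ] * f (suc w)) ≡⟨ trans (+-identityˡ (∑ (allFin n) (λ w → [ a == w ] * f (suc w)))) (∑-delta n a (f ∘ suc)) ⟩
    f (suc a) ∎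

  ι : ℤ → ℚ
  ι i = i / 1

  coprime-1 : ∀ n → Coprime n 1
  coprime-1 n = Coprimality.sym (1-coprimeTo n)

  ι-mkℚ : ∀ i → ι i ≡ mkℚ i 0 (coprime-1 ℤ.∣ i ∣)
  ι-mkℚ (ℤ.+ n) = ℚP.normalize-coprime (coprime-1 n)
  ι-mkℚ -[1+ n ] = cong -_ (ℚP.normalize-coprime (coprime-1 (suc n)))

  ι-+ : ∀ a b → ι (a ℤ.+ b) ≡ ι a + ι b
  ι-+ a b rewrite ι-mkℚ a | ι-mkℚ b = cong (_/ 1) (cong₂ ℤ._+_ (sym (ℤP.*-identityʳ a)) (sym (ℤP.*-identityʳ b)))

  ι-* : ∀ a b → ι (a ℤ.* b) ≡ ι a * ι b
  ι-* a b rewrite ι-mkℚ a | ι-mkℚ b = refl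

  ι-neg : ∀ a → ι (ℤ.- a) ≡ - ι a
  ι-neg (ℤ.+ zero) = refl
  ι-neg (ℤ.+ suc n) rewrite ι-mkℚ (ℤ.+ suc n) = refl
  ι-neg -[1+ n ] rewrite ι-mkℚ (ℤ.+ suc n) = refl

  toℚ-+ : ∀ a b → toℚ (a ℕ.+ b) ≡ toℚ a + toℚ b
  toℚ-+ a b = ι-+ (ℤ.+ a) (ℤ.+ b)

  toℚ-* : ∀ a b → toℚ (a ℕ.* b) ≡ toℚ a * toℚ b
  toℚ-* a b = trans (cong ι (ℤP.pos-* a b)) (ι-* (ℤ.+ a) (ℤ.+ b))

  toℚ-suc : ∀ a → toℚ (suc a) ≡ 1ℚ + toℚ a
  toℚ-suc a = toℚ-+ 1 a

  scalePoly : ℚ → Poly → Poly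
  scalePoly c m = map (c *_) m

  addPoly : Poly → Poly → Poly
  addPoly [] q = q
  addPoly (a ∷ p) [] = a ∷ p
  addPoly (a ∷ p) (b ∷ q) = (a + b) ∷ addPoly p q

  nℚ : ℕ → ℚ
  nℚ n = toℚ n

  eval-scalePoly : ∀ c m n → evalPoly (scalePoly c m) n ≡ c * evalPoly m n
  eval-scalePoly c [] n = sym (*-zeroʳ c)
  eval-scalePoly c (a ∷ m) n = begin
    c * a + nℚ n * evalPoly (scalePoly c m) n ≡⟨ cong (λ z → c * a + nℚ n * z) (eval-scalePoly c m n) ⟩
    c * a + nℚ n * (c * evalPoly m n) ≡⟨ solve 4 (λ c a x e → c :* a :+ x :* (c :* e) := c :* (a :+ x :* e)) refl c a (nℚ n) (evalPoly m n) ⟩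
    c * (a + nℚ n * evalPoly m n) ∎

  coeff-scalePoly : ∀ c m i → coeff (scalePoly c m) i ≡ c * coeff m i
  coeff-scalePoly c [] i = sym (*-zeroʳ c)
  coeff-scalePoly c (a ∷ m) zero = refl
  coeff-scalePoly c (a ∷ m) (suc i) = coeff-scalePoly c m i

  eval-addPoly : ∀ p q n → evalPoly (addPoly p q) n ≡ evalPoly p n + evalPoly q n
  eval-addPoly [] q n = sym (+-identityˡ _)
  eval-addPoly (a ∷ p) [] n = sym (+-identityʳ _)
  eval-addPoly (a ∷ p) (b ∷ q) n = begin
    a + b + nℚ n * evalPoly (addPoly p q) n ≡⟨ cong (λ z → a + b + nℚ n * z) (eval-addPoly p q n) ⟩
    a + b + nℚ n * (evalPoly p n + evalPoly q n) ≡⟨ solve 5 (λ a b x e f → a :+ b :+ x :* (e :+ f) := (a :+ x :* e) :+ (b :+ x :* f)) refl a b (nℚ n) (evalPoly p n) (evalPoly q n) ⟩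
    (a + nℚ n * evalPoly p n) + (b + nℚ n * evalPoly q n) ∎

  coeff-addPoly : ∀ p q i → coeff (addPoly p q) i ≡ coeff p i + coeff q i
  coeff-addPoly [] q i = sym (+-identityˡ _)
  coeff-addPoly (a ∷ p) [] zero = sym (+-identityʳ _)
  coeff-addPoly (a ∷ p) [] (suc i) = sym (+-identityʳ _)
  coeff-addPoly (a ∷ p) (b ∷ q) zero = refl
  coeff-addPoly (a ∷ p) (b ∷ q) (suc i) = coeff-addPoly p q i

  linearFactorPoly : ℚ → Poly → Poly
  linearFactorPoly c m = addPoly (0ℚ ∷ m) (scalePoly (- c) m)

  eval-linearFactorPoly : ∀ c m n → evalPoly (linearFactorPoly c m) n ≡ (nℚ n - c) * evalPoly m n
  eval-linearFactorPoly c m n = begin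
    evalPoly (linearFactorPoly c m) n ≡⟨ eval-addPoly (0ℚ ∷ m) (scalePoly (- c) m) n ⟩
    (0ℚ + nℚ n * evalPoly m n) + evalPoly (scalePoly (- c) m) n ≡⟨ cong ((0ℚ + nℚ n * evalPoly m n) +_) (eval-scalePoly (- c) m n) ⟩
    (0ℚ + nℚ n * evalPoly m n) + (- c) * evalPoly m n ≡⟨ solve 3 (λ x e c → (con 0ℚ :+ x :* e) :+ (:- c) :* e := (x :- c) :* e) refl (nℚ n) (evalPoly m n) c ⟩
    (nℚ n - c) * evalPoly m n ∎

  ≢0-+ : ∀ a b → a + b ≢ 0ℚ → (a ≢ 0ℚ) ⊎ (b ≢ 0ℚ)
  ≢0-+ a b ne with a ℚP.≟ 0ℚ
  ... | no a≠0 = inj₁ a≠0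
  ... | yes refl = inj₂ (λ b0 → ne (trans (+-identityˡ b) b0))

  ≢0-* : ∀ a b → a * b ≢ 0ℚ → b ≢ 0ℚ
  ≢0-* a b ne b0 = ne (trans (cong (a *_) b0) (*-zeroʳ a))

  Admissible : ℕ → Graph × Poly → Set
  Admissible b Jm = NoIsolatedVertices (proj₁ Jm) × DegBound (size (proj₁ Jm)) (proj₂ Jm) b

  Expressible : ℕ → (Graph → ℚ) → Set
  Expressible b f = ∃[ 𝒥 ] (All (Admissible b) 𝒥 × ((G : Graph) → f G ≡ rhs 𝒥 G))

  rhs-++ : ∀ xs ys G → rhs (xs L.++ ys) G ≡ rhs xs G + rhs ys G
  rhs-++ [] ys G = sym (+-identityˡ _)
  rhs-++ ((J , m) ∷ xs) ys G = trans (cong (t +_) (rhs-++ xs ys G)) (sym (+-assoc t (rhs xs G) (rhs ys G)))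
    where t = evalPoly m (size G) * ι (j J G)

  expr-zero : ∀ {b} → Expressible b (λ _ → 0ℚ)
  expr-zero = [] , [] , λ G → refl

  expr-cong : ∀ {b f g} → (∀ G → f G ≡ g G) → Expressible b f → Expressible b g
  expr-cong e (𝒥 , a , h) = 𝒥 , a , λ G → trans (sym (e G)) (h G)

  expr-+ : ∀ {b f g} → Expressible b f → Expressible b g → Expressible b (λ G → f G + g G)
  expr-+ (𝒥 , a , h) (𝒥' , a' , h') = 𝒥 L.++ 𝒥' , AllP.++⁺ a a' , λ G → trans (cong₂ _+_ (h G) (h' G)) (sym (rhs-++ 𝒥 𝒥' G))

  mapPoly : (Poly → Poly) → List (Graph × Poly) → List (Graph × Poly)
  mapPoly t = map (λ Jm → proj₁ Jm , t (proj₂ Jm))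

  rhs-scale : ∀ c 𝒥 G → c * rhs 𝒥 G ≡ rhs (mapPoly (scalePoly c) 𝒥) G
  rhs-scale c [] G = *-zeroʳ c
  rhs-scale c ((J , m) ∷ 𝒥) G = begin
    c * (evalPoly m (size G) * ι (j J G) + rhs 𝒥 G) ≡⟨ *-distribˡ-+ c _ _ ⟩
    c * (evalPoly m (size G) * ι (j J G)) + c * rhs 𝒥 G ≡⟨ cong₂ _+_ (trans (sym (*-assoc c _ _)) (cong (_* ι (j J G)) (sym (eval-scalePoly c m (size G))))) (rhs-scale c 𝒥 G) ⟩
    evalPoly (scalePoly c m) (size G) * ι (j J G) + rhs (mapPoly (scalePoly c) 𝒥) G ∎

  expr-scale : ∀ {b f} (c : ℚ) → Expressible b f → Expressible b (λ G → c * f G)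
  expr-scale {b} c (𝒥 , a , h) = mapPoly (scalePoly c) 𝒥 , scaled-admissible 𝒥 a , λ G → trans (cong (c *_) (h G)) (rhs-scale c 𝒥 G)
    where
    scaled-admissible : ∀ 𝒥 → All (Admissible b) 𝒥 → All (Admissible b) (mapPoly (scalePoly c) 𝒥)
    scaled-admissible [] [] = []
    scaled-admissible ((J , m) ∷ 𝒥) ((ni , db) ∷ a) = (ni , λ i ne → db i (≢0-* c (coeff m i) (λ e → ne (trans (coeff-scalePoly c m i) e)))) ∷ scaled-admissible 𝒥 a

  expr-weaken : ∀ {b b' f} → b ≤ b' → Expressible b f → Expressible b' f
  expr-weaken {b} {b'} le (𝒥 , a , h) = 𝒥 , All.map (λ { (ni , db) → ni , λ i ne → ℕP.≤-trans (db i ne) le }) a , h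

  -- Multiplying by the linear factor (n - c) raises every degree by one, so it
  -- costs one unit of the bound.
  expr-linearFactor : ∀ {b f} (c : ℚ) → Expressible b f → Expressible (suc b) (λ G → (nℚ (size G) - c) * f G)
  expr-linearFactor {b} {f} c (𝒥 , a , h) = mapPoly (linearFactorPoly c) 𝒥 , shifted-admissible 𝒥 a , λ G → trans (cong ((nℚ (size G) - c) *_) (h G)) (rhs-linearFactor 𝒥 G)
    where
    shifted-admissible : ∀ 𝒥 → All (Admissible b) 𝒥 → All (Admissible (suc b)) (mapPoly (linearFactorPoly c) 𝒥)
    shifted-admissible [] [] = []
    shifted-admissible ((J , m) ∷ 𝒥) ((ni , db) ∷ a) = (ni , dl) ∷ shifted-admissible 𝒥 a
      where
      dl : DegBound (size J) (linearFactorPoly c m) (suc b)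
      dl i ne with ≢0-+ (coeff (0ℚ ∷ m) i) (coeff (scalePoly (- c) m) i) (λ e → ne (trans (coeff-addPoly (0ℚ ∷ m) (scalePoly (- c) m) i) e))
      dl zero ne | inj₁ x = ⊥-elim (x refl)
      dl (suc i) ne | inj₁ x = subst (_≤ suc b) (sym (ℕP.+-suc (size J) i)) (ℕ.s≤s (db i x))
      dl i ne | inj₂ y = ℕP.m≤n⇒m≤1+n (db i (≢0-* (- c) (coeff m i) (λ e → y (trans (coeff-scalePoly (- c) m i) e))))
    rhs-linearFactor : ∀ 𝒥 G → (nℚ (size G) - c) * rhs 𝒥 G ≡ rhs (mapPoly (linearFactorPoly c) 𝒥) G
    rhs-linearFactor [] G = *-zeroʳ (nℚ (size G) - c)
    rhs-linearFactor ((J , m) ∷ 𝒥) G = begin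
      (nℚ (size G) - c) * (evalPoly m (size G) * ι (j J G) + rhs 𝒥 G) ≡⟨ *-distribˡ-+ (nℚ (size G) - c) (evalPoly m (size G) * ι (j J G)) (rhs 𝒥 G) ⟩
      (nℚ (size G) - c) * (evalPoly m (size G) * ι (j J G)) + (nℚ (size G) - c) * rhs 𝒥 G
        ≡⟨ cong₂ _+_ (trans (sym (*-assoc (nℚ (size G) - c) (evalPoly m (size G)) (ι (j J G)))) (cong (_* ι (j J G)) (sym (eval-linearFactorPoly c m (size G))))) (rhs-linearFactor 𝒥 G) ⟩
      evalPoly (linearFactorPoly c m) (size G) * ι (j J G) + rhs (mapPoly (linearFactorPoly c) 𝒥) G ∎

  expr-∑ : ∀ {b} {A : Set} (xs : List A) {f : A → Graph → ℚ} → (∀ x → Expressible b (f x)) → Expressible b (λ G → ∑ xs (λ x → f x G))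
  expr-∑ [] e = expr-zero
  expr-∑ (x ∷ xs) e = expr-+ (e x) (expr-∑ xs e)

  expr-j : (H : Graph) → NoIsolatedVertices H → Expressible (size H) (λ G → ι (j H G))
  expr-j H ni = ((H , 1ℚ ∷ []) ∷ []) , ((ni , db) ∷ []) , λ G → sym (trans (+-identityʳ _) (trans (cong (_* ι (j H G)) (trans (cong (1ℚ +_) (*-zeroʳ (nℚ (size G)))) (+-identityʳ 1ℚ))) (*-identityˡ _)))
    where
    db : DegBound (size H) (1ℚ ∷ []) (size H)
    db zero ne = ℕP.≤-reflexive (ℕP.+-identityʳ (size H))
    db (suc i) ne = ⊥-elim (ne refl)

  Tuples : (n r : ℕ) → List (Vec (Fin n) r)
  Tuples n r = allVecs (allFin n) r

  module _ {A : Set} where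
    ∑-allVecs-suc : (xs : List A) (r : ℕ) (F : Vec A (suc r) → ℚ) →
      ∑ (allVecs xs (suc r)) F ≡ ∑ xs (λ a → ∑ (allVecs xs r) (λ Ψ → F (a ∷ Ψ)))
    ∑-allVecs-suc xs r F = trans (∑-concatMap (λ x → map (x ∷_) (allVecs xs r)) xs F) (∑-cong xs (λ a → ∑-map (a ∷_) (allVecs xs r) F))

    ∑-allVecs-zero : (xs : List A) (F : Vec A zero → ℚ) → ∑ (allVecs xs zero) F ≡ F []
    ∑-allVecs-zero xs F = +-identityʳ (F [])

    ∑-insertAt : (xs : List A) (r : ℕ) (i : Fin (suc r)) (F : Vec A (suc r) → ℚ) →
      ∑ (allVecs xs (suc r)) F ≡ ∑ xs (λ w → ∑ (allVecs xs r) (λ Ψ → F (V.insertAt Ψ i w)))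
    ∑-insertAt xs r zero F = ∑-allVecs-suc xs r F
    ∑-insertAt xs (suc r) (suc i) F = begin
      ∑ (allVecs xs (suc (suc r))) F ≡⟨ ∑-allVecs-suc xs (suc r) F ⟩
      ∑ xs (λ a → ∑ (allVecs xs (suc r)) (λ Ψ → F (a ∷ Ψ))) ≡⟨ ∑-cong xs (λ a → ∑-insertAt xs r i (λ Ψ → F (a ∷ Ψ))) ⟩
      ∑ xs (λ a → ∑ xs (λ w → ∑ (allVecs xs r) (λ Ψ → F (a ∷ V.insertAt Ψ i w)))) ≡⟨ ∑-swap xs xs _ ⟩
      ∑ xs (λ w → ∑ xs (λ a → ∑ (allVecs xs r) (λ Ψ → F (a ∷ V.insertAt Ψ i w)))) ≡⟨ ∑-cong xs (λ w → sym (∑-allVecs-suc xs r (λ Ψ → F (V.insertAt Ψ (suc i) w)))) ⟩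
      ∑ xs (λ w → ∑ (allVecs xs (suc r)) (λ Ψ → F (V.insertAt Ψ (suc i) w))) ∎

    ∑-split : (xs : List A) (a b : ℕ) (F : Vec A (a ℕ.+ b) → ℚ) →
      ∑ (allVecs xs (a ℕ.+ b)) F ≡ ∑ (allVecs xs a) (λ Ψ1 → ∑ (allVecs xs b) (λ Ψ2 → F (Ψ1 V.++ Ψ2)))
    ∑-split xs zero b F = sym (∑-allVecs-zero xs (λ Ψ1 → ∑ (allVecs xs b) (λ Ψ2 → F (Ψ1 V.++ Ψ2))))
    ∑-split xs (suc a) b F = begin
      ∑ (allVecs xs (suc (a ℕ.+ b))) F ≡⟨ ∑-allVecs-suc xs (a ℕ.+ b) F ⟩
      ∑ xs (λ x → ∑ (allVecs xs (a ℕ.+ b)) (λ Ψ → F (x ∷ Ψ))) ≡⟨ ∑-cong xs (λ x → ∑-split xs a b (λ Ψ → F (x ∷ Ψ))) ⟩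
      ∑ xs (λ x → ∑ (allVecs xs a) (λ Ψ1 → ∑ (allVecs xs b) (λ Ψ2 → F (x ∷ (Ψ1 V.++ Ψ2))))) ≡⟨ sym (∑-allVecs-suc xs a _) ⟩
      ∑ (allVecs xs (suc a)) (λ Ψ1 → ∑ (allVecs xs b) (λ Ψ2 → F (Ψ1 V.++ Ψ2))) ∎

    allV : (A → Bool) → ∀ {k} → Vec A k → Bool
    allV p [] = true
    allV p (a ∷ Ψ) = p a ∧ allV p Ψ

    allV-lookup : (p : A → Bool) → ∀ {k} (Ψ : Vec A k) → allV p Ψ ≡ true → ∀ i → p (lookup Ψ i) ≡ true
    allV-lookup p (a ∷ Ψ) e zero with p a | e
    ... | true | _ = refl
    allV-lookup p (a ∷ Ψ) e (suc i) with p a | e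
    ... | true | e' = allV-lookup p Ψ e' i

    ∑-allVecs-filter : (p : A → Bool) (xs : List A) (k : ℕ) (F : Vec A k → ℚ) →
      ∑ (allVecs (filterᵇ p xs) k) F ≡ ∑ (allVecs xs k) (λ Ψ → [ allV p Ψ ] * F Ψ)
    ∑-allVecs-filter p xs zero F = trans (∑-allVecs-zero (filterᵇ p xs) F) (trans (sym (*-identityˡ (F []))) (sym (∑-allVecs-zero xs (λ Ψ → [ allV p Ψ ] * F Ψ))))
    ∑-allVecs-filter p xs (suc k) F = begin
      ∑ (allVecs (filterᵇ p xs) (suc k)) F ≡⟨ ∑-allVecs-suc (filterᵇ p xs) k F ⟩
      ∑ (filterᵇ p xs) (λ a → ∑ (allVecs (filterᵇ p xs) k) (λ Ψ → F (a ∷ Ψ))) ≡⟨ ∑-filter p xs _ ⟩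
      ∑ xs (λ a → [ p a ] * ∑ (allVecs (filterᵇ p xs) k) (λ Ψ → F (a ∷ Ψ))) ≡⟨ ∑-cong xs (λ a → cong ([ p a ] *_) (∑-allVecs-filter p xs k (λ Ψ → F (a ∷ Ψ)))) ⟩
      ∑ xs (λ a → [ p a ] * ∑ (allVecs xs k) (λ Ψ → [ allV p Ψ ] * F (a ∷ Ψ))) ≡⟨ ∑-cong xs (λ a → trans (∑-*ˡ (allVecs xs k) [ p a ] _) (∑-cong (allVecs xs k) (λ Ψ → trans (sym (*-assoc [ p a ] [ allV p Ψ ] (F (a ∷ Ψ)))) (cong (_* F (a ∷ Ψ)) (sym ([∧] (p a) (allV p Ψ))))))) ⟩
      ∑ xs (λ a → ∑ (allVecs xs k) (λ Ψ → [ allV p (a ∷ Ψ) ] * F (a ∷ Ψ))) ≡⟨ sym (∑-allVecs-suc xs k _) ⟩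
      ∑ (allVecs xs (suc k)) (λ Ψ → [ allV p Ψ ] * F Ψ) ∎

    ∏∑-distrib : (xs : List A) (r : ℕ) (f : Fin r → A → ℚ) →
      ∏ (allFin r) (λ u → ∑ xs (f u)) ≡ ∑ (allVecs xs r) (λ g → ∏ (allFin r) (λ u → f u (lookup g u)))
    ∏∑-distrib xs zero f = sym (∑-allVecs-zero xs (λ g → ∏ (allFin zero) (λ u → f u (lookup g u))))
    ∏∑-distrib xs (suc r) f = begin
      ∏ (allFin (suc r)) (λ u → ∑ xs (f u)) ≡⟨ ∏-allFin-suc r (λ u → ∑ xs (f u)) ⟩
      ∑ xs (f zero) * ∏ (allFin r) (λ u → ∑ xs (f (suc u))) ≡⟨ cong (∑ xs (f zero) *_) (∏∑-distrib xs r (f ∘ suc)) ⟩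
      ∑ xs (f zero) * ∑ (allVecs xs r) (λ g → ∏ (allFin r) (λ u → f (suc u) (lookup g u))) ≡⟨ ∑-*ʳ xs _ (f zero) ⟩
      ∑ xs (λ a → f zero a * ∑ (allVecs xs r) (λ g → ∏ (allFin r) (λ u → f (suc u) (lookup g u)))) ≡⟨ ∑-cong xs (λ a → ∑-*ˡ (allVecs xs r) (f zero a) _) ⟩
      ∑ xs (λ a → ∑ (allVecs xs r) (λ g → f zero a * ∏ (allFin r) (λ u → f (suc u) (lookup g u)))) ≡⟨ ∑-cong xs (λ a → ∑-cong (allVecs xs r) (λ g → sym (∏-allFin-suc r (λ u → f u (lookup (a ∷ g) u))))) ⟩
      ∑ xs (λ a → ∑ (allVecs xs r) (λ g → ∏ (allFin (suc r)) (λ u → f u (lookup (a ∷ g) u)))) ≡⟨ sym (∑-allVecs-suc xs r _) ⟩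
      ∑ (allVecs xs (suc r)) (λ g → ∏ (allFin (suc r)) (λ u → f u (lookup g u))) ∎

    ∑-delta-vec : (xs : List A) (δ : A → A → ℚ) → (∀ y (h : A → ℚ) → ∑ xs (λ x → δ x y * h x) ≡ h y) →
      ∀ r (d : Vec A r) (g : Vec A r → ℚ) →
      ∑ (allVecs xs r) (λ c → ∏ (allFin r) (λ u → δ (lookup c u) (lookup d u)) * g c) ≡ g d
    ∑-delta-vec xs δ hδ zero [] g = trans (∑-allVecs-zero xs (λ c → ∏ (allFin zero) (λ u → δ (lookup c u) (lookup {n = zero} [] u)) * g c)) (*-identityˡ (g []))
    ∑-delta-vec xs δ hδ (suc r) (y ∷ d) g = begin
      ∑ (allVecs xs (suc r)) (λ c → ∏ (allFin (suc r)) (λ u → δ (lookup c u) (lookup (y ∷ d) u)) * g c) ≡⟨ ∑-allVecs-suc xs r _ ⟩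
      ∑ xs (λ a → ∑ (allVecs xs r) (λ c → ∏ (allFin (suc r)) (λ u → δ (lookup (a ∷ c) u) (lookup (y ∷ d) u)) * g (a ∷ c)))
        ≡⟨ ∑-cong xs (λ a → ∑-cong (allVecs xs r) (λ c → trans (cong (_* g (a ∷ c)) (∏-allFin-suc r (λ u → δ (lookup (a ∷ c) u) (lookup (y ∷ d) u)))) (*-assoc (δ a y) (∏ (allFin r) (λ u → δ (lookup c u) (lookup d u))) (g (a ∷ c))))) ⟩
      ∑ xs (λ a → ∑ (allVecs xs r) (λ c → δ a y * (∏ (allFin r) (λ u → δ (lookup c u) (lookup d u)) * g (a ∷ c))))
        ≡⟨ ∑-cong xs (λ a → sym (∑-*ˡ (allVecs xs r) (δ a y) _)) ⟩
      ∑ xs (λ a → δ a y * ∑ (allVecs xs r) (λ c → ∏ (allFin r) (λ u → δ (lookup c u) (lookup d u)) * g (a ∷ c)))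
        ≡⟨ ∑-cong xs (λ a → cong (δ a y *_) (∑-delta-vec xs δ hδ r d (λ c → g (a ∷ c)))) ⟩
      ∑ xs (λ a → δ a y * g (a ∷ d)) ≡⟨ hδ y (λ a → g (a ∷ d)) ⟩
      g (y ∷ d) ∎

  module _ {A B : Set} where
    ∑-allVecs-map : (g : A → B) (xs : List A) (k : ℕ) (F : Vec B k → ℚ) →
      ∑ (allVecs (map g xs) k) F ≡ ∑ (allVecs xs k) (F ∘ V.map g)
    ∑-allVecs-map g xs zero F = trans (∑-allVecs-zero (map g xs) F) (sym (∑-allVecs-zero xs (F ∘ V.map g)))
    ∑-allVecs-map g xs (suc k) F = begin
      ∑ (allVecs (map g xs) (suc k)) F ≡⟨ ∑-allVecs-suc (map g xs) k F ⟩
      ∑ (map g xs) (λ a → ∑ (allVecs (map g xs) k) (λ Ψ → F (a ∷ Ψ))) ≡⟨ ∑-map g xs _ ⟩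
      ∑ xs (λ a → ∑ (allVecs (map g xs) k) (λ Ψ → F (g a ∷ Ψ))) ≡⟨ ∑-cong xs (λ a → ∑-allVecs-map g xs k (λ Ψ → F (g a ∷ Ψ))) ⟩
      ∑ xs (λ a → ∑ (allVecs xs k) (λ Ψ → F (g a ∷ V.map g Ψ))) ≡⟨ sym (∑-allVecs-suc xs k _) ⟩
      ∑ (allVecs xs (suc k)) (F ∘ V.map g) ∎

  indicator-cong : ∀ (b : Bool) x y → (b ≡ true → x ≡ y) → [ b ] * x ≡ [ b ] * y
  indicator-cong true x y e = cong (1ℚ *_) (e refl)
  indicator-cong false x y e = trans (*-zeroˡ x) (sym (*-zeroˡ y))


  not-true : ∀ {a} → not a ≡ true → a ≡ false
  not-true {false} e = refl

  occurs : ∀ {n k} → Fin n → Vec (Fin n) k → Bool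
  occurs w [] = false
  occurs w (a ∷ Ψ) = (a == w) ∨ occurs w Ψ

  distinct : ∀ {n k} → Vec (Fin n) k → Bool
  distinct [] = true
  distinct (a ∷ Ψ) = not (occurs a Ψ) ∧ distinct Ψ

  firstOcc : ∀ {n k} → Vec (Fin n) k → Fin k → Bool
  firstOcc (a ∷ Ψ) zero = true
  firstOcc (a ∷ Ψ) (suc i) = not (a == lookup Ψ i) ∧ firstOcc Ψ i

  occurs-lookup-false : ∀ {n k} (w : Fin n) (Ψ : Vec (Fin n) k) → occurs w Ψ ≡ false → ∀ i → (lookup Ψ i == w) ≡ false
  occurs-lookup-false w (a ∷ Ψ) e zero with a == w | e
  ... | false | _ = refl
  occurs-lookup-false w (a ∷ Ψ) e (suc i) with a == w | e
  ... | false | e' = occurs-lookup-false w Ψ e' i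

  occurs-lookup : ∀ {n k} (Ψ : Vec (Fin n) k) i → occurs (lookup Ψ i) Ψ ≡ true
  occurs-lookup (a ∷ Ψ) zero rewrite ==-refl a = refl
  occurs-lookup (a ∷ Ψ) (suc i) rewrite occurs-lookup Ψ i with a == lookup Ψ i
  ... | true = refl
  ... | false = refl

  firstOcc-distinct : ∀ {n k} (Ψ : Vec (Fin n) k) → distinct Ψ ≡ true → ∀ i → firstOcc Ψ i ≡ true
  firstOcc-distinct (a ∷ Ψ) e zero = refl
  firstOcc-distinct (a ∷ Ψ) e (suc i)
    rewrite ==-sym a (lookup Ψ i) | occurs-lookup-false a Ψ (not-true (∧-conicalˡ _ _ e)) i = firstOcc-distinct Ψ (∧-conicalʳ _ _ e) i

  ∑-occurs : ∀ n k (Ψ : Vec (Fin n) k) (h : Fin n → ℚ) →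
    ∑ (allFin n) (λ w → [ occurs w Ψ ] * h w) ≡ ∑ (allFin k) (λ i → [ firstOcc Ψ i ] * h (lookup Ψ i))
  ∑-occurs n zero [] h = ∑-vanish (allFin n) _ (λ w → *-zeroˡ (h w))
  ∑-occurs n (suc k) (a ∷ Ψ) h = begin
    ∑ (allFin n) (λ w → [ (a == w) ∨ occurs w Ψ ] * h w)
      ≡⟨ ∑-cong (allFin n) (λ w → trans (cong (_* h w) ([∨] (a == w) (occurs w Ψ)))
           (solve 4 (λ x y z hh → (x :+ y :* z) :* hh := x :* hh :+ z :* (y :* hh)) refl [ a == w ] [ not (a == w) ] [ occurs w Ψ ] (h w))) ⟩
    ∑ (allFin n) (λ w → [ a == w ] * h w + [ occurs w Ψ ] * ([ not (a == w) ] * h w))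
      ≡⟨ ∑-+ (allFin n) _ _ ⟩
    ∑ (allFin n) (λ w → [ a == w ] * h w) + ∑ (allFin n) (λ w → [ occurs w Ψ ] * ([ not (a == w) ] * h w))
      ≡⟨ cong₂ _+_ (∑-delta n a h) (∑-occurs n k Ψ (λ w → [ not (a == w) ] * h w)) ⟩
    h a + ∑ (allFin k) (λ i → [ firstOcc Ψ i ] * ([ not (a == lookup Ψ i) ] * h (lookup Ψ i)))
      ≡⟨ cong₂ _+_ (sym (*-identityˡ (h a))) (∑-cong (allFin k) (λ i →
           trans (solve 3 (λ x y hh → x :* (y :* hh) := (y :* x) :* hh) refl [ firstOcc Ψ i ] [ not (a == lookup Ψ i) ] (h (lookup Ψ i)))
                 (cong (_* h (lookup Ψ i)) (sym ([∧] (not (a == lookup Ψ i)) (firstOcc Ψ i)))))) ⟩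
    1ℚ * h a + ∑ (allFin k) (λ i → [ firstOcc (a ∷ Ψ) (suc i) ] * h (lookup (a ∷ Ψ) (suc i)))
      ≡⟨ sym (∑-allFin-suc k (λ i → [ firstOcc (a ∷ Ψ) i ] * h (lookup (a ∷ Ψ) i))) ⟩
    ∑ (allFin (suc k)) (λ i → [ firstOcc (a ∷ Ψ) i ] * h (lookup (a ∷ Ψ) i)) ∎

  ∑-occurs-distinct : ∀ n k (Ψ : Vec (Fin n) k) (h : Fin n → ℚ) → distinct Ψ ≡ true →
    ∑ (allFin n) (λ w → [ occurs w Ψ ] * h w) ≡ ∑ (allFin k) (λ i → h (lookup Ψ i))
  ∑-occurs-distinct n k Ψ h e = trans (∑-occurs n k Ψ h) (∑-cong (allFin k) (λ i → trans (cong (λ b → [ b ] * h (lookup Ψ i)) (firstOcc-distinct Ψ e i)) (*-identityˡ _)))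

  ∑-ones : ∀ n → ∑ (allFin n) (λ _ → 1ℚ) ≡ toℚ n
  ∑-ones zero = refl
  ∑-ones (suc n) = trans (∑-allFin-suc n (λ _ → 1ℚ)) (trans (cong (1ℚ +_) (∑-ones n)) (sym (toℚ-suc n)))

  falling : ℚ → ℕ → ℚ
  falling c zero = 1ℚ
  falling c (suc k) = (c - toℚ k) * falling c k

  count-distinct-inside : ∀ n k (P : Fin n → Bool) →
    ∑ (Tuples n k) (λ Ψ → [ distinct Ψ ] * [ allV P Ψ ]) ≡ falling (∑ (allFin n) (λ w → [ P w ])) k
  count-distinct-inside n zero P = trans (∑-allVecs-zero (allFin n) (λ Ψ → [ distinct Ψ ] * [ allV P Ψ ])) (*-identityˡ 1ℚ)
  count-distinct-inside n (suc k) P = begin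
    ∑ (Tuples n (suc k)) (λ Ψ → [ distinct Ψ ] * [ allV P Ψ ]) ≡⟨ ∑-allVecs-suc (allFin n) k _ ⟩
    ∑ (allFin n) (λ a → ∑ (Tuples n k) (λ Ψ → [ not (occurs a Ψ) ∧ distinct Ψ ] * [ P a ∧ allV P Ψ ])) ≡⟨ ∑-swap (allFin n) (Tuples n k) _ ⟩
    ∑ (Tuples n k) (λ Ψ → ∑ (allFin n) (λ a → [ not (occurs a Ψ) ∧ distinct Ψ ] * [ P a ∧ allV P Ψ ]))
      ≡⟨ ∑-cong (Tuples n k) (λ Ψ → trans (∑-cong (allFin n) (λ a → trans (cong₂ _*_ ([∧] (not (occurs a Ψ)) (distinct Ψ)) ([∧] (P a) (allV P Ψ)))
            (solve 4 (λ x y z w → (x :* y) :* (z :* w) := (y :* w) :* (z :* x)) refl [ not (occurs a Ψ) ] [ distinct Ψ ] [ P a ] [ allV P Ψ ])))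
            (sym (∑-*ˡ (allFin n) ([ distinct Ψ ] * [ allV P Ψ ]) _))) ⟩
    ∑ (Tuples n k) (λ Ψ → ([ distinct Ψ ] * [ allV P Ψ ]) * ∑ (allFin n) (λ a → [ P a ] * [ not (occurs a Ψ) ]))
      ≡⟨ ∑-cong (Tuples n k) (λ Ψ → trans (cong (_* ∑ (allFin n) (λ a → [ P a ] * [ not (occurs a Ψ) ])) (sym ([∧] (distinct Ψ) (allV P Ψ))))
            (trans (indicator-cong (distinct Ψ ∧ allV P Ψ) _ _ (outside Ψ)) (cong (_* (cP - toℚ k)) ([∧] (distinct Ψ) (allV P Ψ))))) ⟩
    ∑ (Tuples n k) (λ Ψ → ([ distinct Ψ ] * [ allV P Ψ ]) * (cP - toℚ k)) ≡⟨ sym (∑-*ʳ (Tuples n k) (cP - toℚ k) _) ⟩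
    ∑ (Tuples n k) (λ Ψ → [ distinct Ψ ] * [ allV P Ψ ]) * (cP - toℚ k) ≡⟨ trans (cong (_* (cP - toℚ k)) (count-distinct-inside n k P)) (*-comm (falling cP k) (cP - toℚ k)) ⟩
    falling cP (suc k) ∎
    where
    cP = ∑ (allFin n) (λ w → [ P w ])
    outside : ∀ Ψ → distinct Ψ ∧ allV P Ψ ≡ true → ∑ (allFin n) (λ a → [ P a ] * [ not (occurs a Ψ) ]) ≡ cP - toℚ k
    outside Ψ e = begin
      ∑ (allFin n) (λ a → [ P a ] * [ not (occurs a Ψ) ])
        ≡⟨ ∑-cong (allFin n) (λ a → trans (cong ([ P a ] *_) ([not] (occurs a Ψ))) (solve 2 (λ p m → p :* (con 1ℚ :- m) := p :+ (:- (m :* p))) refl [ P a ] [ occurs a Ψ ])) ⟩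
      ∑ (allFin n) (λ a → [ P a ] + - ([ occurs a Ψ ] * [ P a ])) ≡⟨ ∑-+ (allFin n) _ _ ⟩
      cP + ∑ (allFin n) (λ a → - ([ occurs a Ψ ] * [ P a ])) ≡⟨ cong (cP +_) (∑-neg (allFin n) _) ⟩
      cP - ∑ (allFin n) (λ a → [ occurs a Ψ ] * [ P a ]) ≡⟨ cong (λ z → cP - z) (∑-occurs-distinct n k Ψ (λ a → [ P a ]) (∧-conicalˡ _ _ e)) ⟩
      cP - ∑ (allFin k) (λ i → [ P (lookup Ψ i) ]) ≡⟨ cong (λ z → cP - z) (trans (∑-cong (allFin k) (λ i → cong [_] (allV-lookup P Ψ (∧-conicalʳ _ _ e) i))) (∑-ones k)) ⟩
      cP - toℚ k ∎

  bool-ext : ∀ {a b : Bool} → (a ≡ true → b ≡ true) → (b ≡ true → a ≡ true) → a ≡ b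
  bool-ext {false} {false} f g = refl
  bool-ext {false} {true} f g = g refl
  bool-ext {true} {false} f g = sym (f refl)
  bool-ext {true} {true} f g = refl

  dec-ext : ∀ {P Q : Set} (p : Dec P) (q : Dec Q) → (P → Q) → (Q → P) → ⌊ p ⌋ ≡ ⌊ q ⌋
  dec-ext (yes p) (yes q) f g = refl
  dec-ext (no ¬p) (no ¬q) f g = refl
  dec-ext (yes p) (no ¬q) f g = ⊥-elim (¬q (f p))
  dec-ext (no ¬p) (yes q) f g = ⊥-elim (¬p (g q))

  -- A graph on the vertex set Fin r; unlike Graph its size is an index, so we
  -- can recurse on it.
  record GraphOn (r : ℕ) : Set where
    field
      edge : Fin r → Fin r → Bool
      edge-sym : ∀ u v → edge u v ≡ edge v u
      edge-irrefl : ∀ v → edge v v ≡ false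
  open GraphOn public

  toGraph : ∀ {r} → GraphOn r → Graph
  toGraph {r} H = record { size = r ; adj = edge H ; sym = edge-sym H ; irrefl = edge-irrefl H }

  spin : Bool → ℚ
  spin b = if b then 1ℚ else - 1ℚ

  edgeMonomial : (H : Graph) (G : Graph) → Vec (Fin (size G)) (size H) → ℚ
  edgeMonomial H G Ψ = ∏ (allFin (size H)) λ u → ∏ (allFin (size H)) λ v →
    if (adj H u v ∧ ⌊ u <? v ⌋) then spin (adj G (lookup Ψ u) (lookup Ψ v)) else 1ℚ

  signedCount : Graph → Graph → ℚ
  signedCount H G = ∑ (Tuples (size G) (size H)) (λ Ψ → [ distinct Ψ ] * edgeMonomial H G Ψ)

  punchIn-< : ∀ {r} (i : Fin (suc r)) (u v : Fin r) → u F.< v → punchIn i u F.< punchIn i v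
  punchIn-< zero u v lt = ℕ.s<s lt
  punchIn-< (suc i) zero (suc v) lt = ℕ.z<s
  punchIn-< (suc i) (suc u) (suc v) (ℕ.s<s lt) = ℕ.s<s (punchIn-< i u v lt)

  punchIn-<⁻ : ∀ {r} (i : Fin (suc r)) (u v : Fin r) → punchIn i u F.< punchIn i v → u F.< v
  punchIn-<⁻ zero u v (ℕ.s<s lt) = lt
  punchIn-<⁻ (suc i) zero zero ()
  punchIn-<⁻ (suc i) zero (suc v) lt = ℕ.z<s
  punchIn-<⁻ (suc i) (suc u) zero ()
  punchIn-<⁻ (suc i) (suc u) (suc v) (ℕ.s<s lt) = ℕ.s<s (punchIn-<⁻ i u v lt)

  punchIn-<? : ∀ {r} (i : Fin (suc r)) (u v : Fin r) → ⌊ punchIn i u <? punchIn i v ⌋ ≡ ⌊ u <? v ⌋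
  punchIn-<? i u v = dec-ext (punchIn i u <? punchIn i v) (u <? v) (punchIn-<⁻ i u v) (punchIn-< i u v)

  deleteVertex : ∀ {r} (H : GraphOn (suc r)) (i : Fin (suc r)) → GraphOn r
  deleteVertex H i = record { edge = λ u v → edge H (punchIn i u) (punchIn i v) ; edge-sym = λ u v → edge-sym H _ _ ; edge-irrefl = λ v → edge-irrefl H _ }

  ∨-swap : ∀ x y z → x ∨ (y ∨ z) ≡ y ∨ (x ∨ z)
  ∨-swap true true z = refl
  ∨-swap true false z = refl
  ∨-swap false y z = refl

  occurs-insertAt : ∀ {n k} (a w : Fin n) (Ψ : Vec (Fin n) k) (i : Fin (suc k)) → occurs a (V.insertAt Ψ i w) ≡ (w == a) ∨ occurs a Ψ
  occurs-insertAt a w Ψ zero = refl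
  occurs-insertAt a w (b ∷ Ψ) (suc i) = trans (cong ((b == a) ∨_) (occurs-insertAt a w Ψ i)) (∨-swap (b == a) (w == a) (occurs a Ψ))

  not∨-∧-swap : ∀ x y z t → not (x ∨ y) ∧ (not z ∧ t) ≡ not (x ∨ z) ∧ (not y ∧ t)
  not∨-∧-swap true y z t = refl
  not∨-∧-swap false true true t = refl
  not∨-∧-swap false true false t = refl
  not∨-∧-swap false false true t = refl
  not∨-∧-swap false false false t = refl

  distinct-insertAt : ∀ {n k} (w : Fin n) (Ψ : Vec (Fin n) k) (i : Fin (suc k)) → distinct (V.insertAt Ψ i w) ≡ not (occurs w Ψ) ∧ distinct Ψ
  distinct-insertAt w Ψ zero = refl
  distinct-insertAt w (a ∷ Ψ) (suc i) = begin
    not (occurs a (V.insertAt Ψ i w)) ∧ distinct (V.insertAt Ψ i w) ≡⟨ cong₂ (λ x y → not x ∧ y) (occurs-insertAt a w Ψ i) (distinct-insertAt w Ψ i) ⟩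
    not ((w == a) ∨ occurs a Ψ) ∧ (not (occurs w Ψ) ∧ distinct Ψ) ≡⟨ cong (λ x → not (x ∨ occurs a Ψ) ∧ (not (occurs w Ψ) ∧ distinct Ψ)) (==-sym w a) ⟩
    not ((a == w) ∨ occurs a Ψ) ∧ (not (occurs w Ψ) ∧ distinct Ψ) ≡⟨ not∨-∧-swap (a == w) (occurs a Ψ) (occurs w Ψ) (distinct Ψ) ⟩
    not ((a == w) ∨ occurs w Ψ) ∧ (not (occurs a Ψ) ∧ distinct Ψ) ∎

  edgeMonomial-isolated : ∀ {r} (H : GraphOn (suc r)) (i : Fin (suc r)) → (∀ u → edge H i u ≡ false) →
    ∀ (G : Graph) (Ψ : Vec (Fin (size G)) r) w → edgeMonomial (toGraph H) G (V.insertAt Ψ i w) ≡ edgeMonomial (toGraph (deleteVertex H i)) G Ψ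
  edgeMonomial-isolated {r} H i iso G Ψ w = begin
    ∏ (allFin (suc r)) (λ u → ∏ (allFin (suc r)) (λ v → g u v)) ≡⟨ ∏-allFin-punchIn r i (λ u → ∏ (allFin (suc r)) (λ v → g u v)) ⟩
    ∏ (allFin (suc r)) (λ v → g i v) * ∏ (allFin r) (λ u → ∏ (allFin (suc r)) (λ v → g (punchIn i u) v))
      ≡⟨ cong₂ _*_ (∏-1 (allFin (suc r)) (g i) gi)
                   (∏-cong (allFin r) (λ u → ∏-allFin-punchIn r i (g (punchIn i u)))) ⟩
    1ℚ * ∏ (allFin r) (λ u → g (punchIn i u) i * ∏ (allFin r) (λ v → g (punchIn i u) (punchIn i v)))
      ≡⟨ trans (*-identityˡ _) (∏-cong (allFin r) (λ u → trans (cong (_* ∏ (allFin r) (λ v → g (punchIn i u) (punchIn i v))) (gu u)) (*-identityˡ (∏ (allFin r) (λ v → g (punchIn i u) (punchIn i v)))))) ⟩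
    ∏ (allFin r) (λ u → ∏ (allFin r) (λ v → g (punchIn i u) (punchIn i v)))
      ≡⟨ ∏-cong (allFin r) (λ u → ∏-cong (allFin r) (λ v →
            cong₂ (λ b x → if edge H (punchIn i u) (punchIn i v) ∧ b then spin x else 1ℚ) (punchIn-<? i u v)
              (cong₂ (adj G) (VP.insertAt-punchIn Ψ i w u) (VP.insertAt-punchIn Ψ i w v)))) ⟩
    edgeMonomial (toGraph (deleteVertex H i)) G Ψ ∎
    where
    L' : Fin (suc r) → Fin (suc r) → ℚ
    L' u v = spin (adj G (lookup (V.insertAt Ψ i w) u) (lookup (V.insertAt Ψ i w) v))
    g : Fin (suc r) → Fin (suc r) → ℚ
    g u v = if (edge H u v ∧ ⌊ u <? v ⌋) then L' u v else 1ℚ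
    gi : ∀ v → g i v ≡ 1ℚ
    gi v = cong (λ b → if b ∧ ⌊ i <? v ⌋ then L' i v else 1ℚ) (iso v)
    gu : ∀ u → g (punchIn i u) i ≡ 1ℚ
    gu u = cong (λ b → if b ∧ ⌊ punchIn i u <? i ⌋ then L' (punchIn i u) i else 1ℚ) (trans (edge-sym H (punchIn i u) i) (iso (punchIn i u)))

  count-outside : ∀ n k (Ψ : Vec (Fin n) k) → distinct Ψ ≡ true → ∑ (allFin n) (λ w → [ not (occurs w Ψ) ]) ≡ toℚ n - toℚ k
  count-outside n k Ψ e = begin
    ∑ (allFin n) (λ w → [ not (occurs w Ψ) ]) ≡⟨ ∑-cong (allFin n) (λ w → trans ([not] (occurs w Ψ)) (cong (1ℚ +_) (cong -_ (sym (*-identityʳ [ occurs w Ψ ]))))) ⟩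
    ∑ (allFin n) (λ w → 1ℚ + - ([ occurs w Ψ ] * 1ℚ)) ≡⟨ ∑-+ (allFin n) _ _ ⟩
    ∑ (allFin n) (λ _ → 1ℚ) + ∑ (allFin n) (λ w → - ([ occurs w Ψ ] * 1ℚ)) ≡⟨ cong₂ _+_ (∑-ones n) (∑-neg (allFin n) _) ⟩
    toℚ n - ∑ (allFin n) (λ w → [ occurs w Ψ ] * 1ℚ) ≡⟨ cong (λ z → toℚ n - z) (trans (∑-occurs-distinct n k Ψ (λ _ → 1ℚ) e) (∑-ones k)) ⟩
    toℚ n - toℚ k ∎

  -- Removing an isolated vertex i: its image ranges freely over the n - r vertices
  -- not used by the others, so signedCount H = (n - r) · signedCount (H - i).
  signedCount-isolated : ∀ {r} (H : GraphOn (suc r)) (i : Fin (suc r)) → (∀ u → edge H i u ≡ false) →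
    ∀ (G : Graph) → signedCount (toGraph H) G ≡ (nℚ (size G) - toℚ r) * signedCount (toGraph (deleteVertex H i)) G
  signedCount-isolated {r} H i iso G = begin
    ∑ (Tuples n (suc r)) (λ Ψ → [ distinct Ψ ] * edgeMonomial (toGraph H) G Ψ) ≡⟨ ∑-insertAt (allFin n) r i _ ⟩
    ∑ (allFin n) (λ w → ∑ (Tuples n r) (λ Ψ → [ distinct (V.insertAt Ψ i w) ] * edgeMonomial (toGraph H) G (V.insertAt Ψ i w)))
      ≡⟨ ∑-cong (allFin n) (λ w → ∑-cong (Tuples n r) (λ Ψ → cong₂ _*_ (trans (cong [_] (distinct-insertAt w Ψ i)) ([∧] (not (occurs w Ψ)) (distinct Ψ))) (edgeMonomial-isolated H i iso G Ψ w))) ⟩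
    ∑ (allFin n) (λ w → ∑ (Tuples n r) (λ Ψ → ([ not (occurs w Ψ) ] * [ distinct Ψ ]) * M' Ψ)) ≡⟨ ∑-swap (allFin n) (Tuples n r) _ ⟩
    ∑ (Tuples n r) (λ Ψ → ∑ (allFin n) (λ w → ([ not (occurs w Ψ) ] * [ distinct Ψ ]) * M' Ψ))
      ≡⟨ ∑-cong (Tuples n r) (λ Ψ → trans (∑-cong (allFin n) (λ w → solve 3 (λ a b c → (a :* b) :* c := (b :* c) :* a) refl [ not (occurs w Ψ) ] [ distinct Ψ ] (M' Ψ))) (sym (∑-*ˡ (allFin n) ([ distinct Ψ ] * M' Ψ) _))) ⟩
    ∑ (Tuples n r) (λ Ψ → ([ distinct Ψ ] * M' Ψ) * ∑ (allFin n) (λ w → [ not (occurs w Ψ) ]))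
      ≡⟨ ∑-cong (Tuples n r) (λ Ψ → trans (*-assoc [ distinct Ψ ] (M' Ψ) _) (trans (indicator-cong (distinct Ψ) _ _ (λ e → cong (M' Ψ *_) (count-outside n r Ψ e))) (sym (*-assoc [ distinct Ψ ] (M' Ψ) _)))) ⟩
    ∑ (Tuples n r) (λ Ψ → ([ distinct Ψ ] * M' Ψ) * (nℚ n - toℚ r)) ≡⟨ sym (∑-*ʳ (Tuples n r) (nℚ n - toℚ r) _) ⟩
    signedCount (toGraph (deleteVertex H i)) G * (nℚ n - toℚ r) ≡⟨ *-comm (signedCount (toGraph (deleteVertex H i)) G) (nℚ n - toℚ r) ⟩
    (nℚ n - toℚ r) * signedCount (toGraph (deleteVertex H i)) G ∎
    where
    n = size G
    M' = edgeMonomial (toGraph (deleteVertex H i)) G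

  ι-sum : ∀ {A : Set} (xs : List A) (f : A → ℤ) → ι (sumℤ (map f xs)) ≡ ∑ xs (ι ∘ f)
  ι-sum [] f = refl
  ι-sum (x ∷ xs) f = trans (ι-+ (f x) (sumℤ (map f xs))) (cong (ι (f x) +_) (ι-sum xs f))

  neg-1 : ∀ a → - a ≡ - 1ℚ * a
  neg-1 a = solve 1 (λ a → :- a := (:- con 1ℚ) :* a) refl a

  sign-count : ∀ {A : Set} (p : A → Bool) (xs : List A) → ι (sign (countᵇ p xs)) ≡ ∏ xs (λ x → if p x then - 1ℚ else 1ℚ)
  sign-count p [] = refl
  sign-count p (x ∷ xs) with p x
  ... | true = trans (ι-neg (sign (countᵇ p xs))) (trans (cong -_ (sign-count p xs)) (neg-1 _))
  ... | false = trans (sign-count p xs) (sym (*-identityˡ _))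

  module _ {A : Set} where
    ∏-++ : (xs ys : List A) (f : A → ℚ) → ∏ (xs L.++ ys) f ≡ ∏ xs f * ∏ ys f
    ∏-++ [] ys f = sym (*-identityˡ _)
    ∏-++ (x ∷ xs) ys f = trans (cong (f x *_) (∏-++ xs ys f)) (sym (*-assoc (f x) (∏ xs f) (∏ ys f)))

  ∏-cart : ∀ {A B : Set} (xs : List A) (ys : List B) (f : A × B → ℚ) → ∏ (cartesianProduct xs ys) f ≡ ∏ xs (λ x → ∏ ys (λ y → f (x , y)))
  ∏-cart [] ys f = refl
  ∏-cart (x ∷ xs) ys f = trans (∏-++ (map (x ,_) ys) _ f) (cong₂ _*_ (∏-map (x ,_) ys f) (∏-cart xs ys f))

  sign≡edgeMonomial : (H G : Graph) (φ : Vec (Fin (size G)) (size H)) → ι (sign (brokenEdges H G φ)) ≡ edgeMonomial H G φ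
  sign≡edgeMonomial H G φ = trans (sign-count _ (cartesianProduct (allFin (size H)) (allFin (size H))))
    (trans (∏-cart (allFin (size H)) (allFin (size H)) (λ uv → if adj H (proj₁ uv) (proj₂ uv) ∧ ⌊ proj₁ uv <? proj₂ uv ⌋ ∧ not (adj G (lookup φ (proj₁ uv)) (lookup φ (proj₂ uv))) then - 1ℚ else 1ℚ)) (∏-cong (allFin (size H)) (λ u → ∏-cong (allFin (size H)) (λ v → pt u v))))
    where
    pt : ∀ u v → (if adj H u v ∧ ⌊ u <? v ⌋ ∧ not (adj G (lookup φ u) (lookup φ v)) then - 1ℚ else 1ℚ)
               ≡ (if adj H u v ∧ ⌊ u <? v ⌋ then spin (adj G (lookup φ u) (lookup φ v)) else 1ℚ)
    pt u v with adj H u v | ⌊ u <? v ⌋ | adj G (lookup φ u) (lookup φ v)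
    ... | true | true | true = refl
    ... | true | true | false = refl
    ... | true | false | _ = refl
    ... | false | _ | _ = refl

  allᵇ-map : ∀ {A B : Set} (p : B → Bool) (f : A → B) (xs : List A) → allᵇ p (map f xs) ≡ allᵇ (p ∘ f) xs
  allᵇ-map p f [] = refl
  allᵇ-map p f (x ∷ xs) = cong (p (f x) ∧_) (allᵇ-map p f xs)

  allᵇ-suc : ∀ k (p : Fin (suc k) → Bool) → allᵇ p (allFin (suc k)) ≡ p zero ∧ allᵇ (p ∘ suc) (allFin k)
  allᵇ-suc k p = trans (cong (allᵇ p) (allFin-suc k)) (cong (p zero ∧_) (allᵇ-map p suc (allFin k)))

  allᵇ-true : ∀ k (p : Fin k → Bool) → allᵇ p (allFin k) ≡ true → ∀ i → p i ≡ true
  allᵇ-true (suc k) p e zero = ∧-conicalˡ _ _ (trans (sym (allᵇ-suc k p)) e)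
  allᵇ-true (suc k) p e (suc i) = allᵇ-true k (p ∘ suc) (∧-conicalʳ _ _ (trans (sym (allᵇ-suc k p)) e)) i

  allᵇ-intro : ∀ k (p : Fin k → Bool) → (∀ i → p i ≡ true) → allᵇ p (allFin k) ≡ true
  allᵇ-intro zero p h = refl
  allᵇ-intro (suc k) p h = trans (allᵇ-suc k p) (cong₂ _∧_ (h zero) (allᵇ-intro k (p ∘ suc) (h ∘ suc)))

  module _ {A : Set} where
    anyᵇ-true : (p : A → Bool) (xs : List A) → anyᵇ p xs ≡ true → ∃ λ x → p x ≡ true
    anyᵇ-true p (x ∷ xs) e with p x in eq
    ... | true = x , eq
    ... | false = anyᵇ-true p xs e

    anyᵇ-++ : (p : A → Bool) (xs ys : List A) → anyᵇ p (xs L.++ ys) ≡ anyᵇ p xs ∨ anyᵇ p ys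
    anyᵇ-++ p [] ys = refl
    anyᵇ-++ p (x ∷ xs) ys rewrite anyᵇ-++ p xs ys with p x
    ... | true = refl
    ... | false = refl

    anyᵇ-filter : (f p : A → Bool) (xs : List A) → anyᵇ p (filterᵇ f xs) ≡ anyᵇ (λ x → f x ∧ p x) xs
    anyᵇ-filter f p [] = refl
    anyᵇ-filter f p (x ∷ xs) with f x
    ... | true = cong (p x ∨_) (anyᵇ-filter f p xs)
    ... | false = anyᵇ-filter f p xs

    anyᵇ-cong : {p q : A → Bool} (xs : List A) → (∀ x → p x ≡ q x) → anyᵇ p xs ≡ anyᵇ q xs
    anyᵇ-cong [] h = refl
    anyᵇ-cong (x ∷ xs) h = cong₂ _∨_ (h x) (anyᵇ-cong xs h)

    allᵇ-cong : {p q : A → Bool} (xs : List A) → (∀ x → p x ≡ q x) → allᵇ p xs ≡ allᵇ q xs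
    allᵇ-cong [] h = refl
    allᵇ-cong (x ∷ xs) h = cong₂ _∧_ (h x) (allᵇ-cong xs h)

  module _ {A B : Set} where
    anyᵇ-map : (p : B → Bool) (f : A → B) (xs : List A) → anyᵇ p (map f xs) ≡ anyᵇ (p ∘ f) xs
    anyᵇ-map p f [] = refl
    anyᵇ-map p f (x ∷ xs) = cong (p (f x) ∨_) (anyᵇ-map p f xs)

    anyᵇ-concatMap : (p : B → Bool) (f : A → List B) (xs : List A) → anyᵇ p (concatMap f xs) ≡ anyᵇ (λ x → anyᵇ p (f x)) xs
    anyᵇ-concatMap p f [] = refl
    anyᵇ-concatMap p f (x ∷ xs) = trans (anyᵇ-++ p (f x) (concatMap f xs)) (cong (anyᵇ p (f x) ∨_) (anyᵇ-concatMap p f xs))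

  ∨-true₁ : ∀ {x} y → x ≡ true → x ∨ y ≡ true
  ∨-true₁ y refl = refl
  ∨-true₂ : ∀ x {y} → y ≡ true → x ∨ y ≡ true
  ∨-true₂ true e = refl
  ∨-true₂ false e = e

  anyᵇ-suc : ∀ k (p : Fin (suc k) → Bool) → anyᵇ p (allFin (suc k)) ≡ p zero ∨ anyᵇ (p ∘ suc) (allFin k)
  anyᵇ-suc k p = trans (cong (anyᵇ p) (allFin-suc k)) (cong (p zero ∨_) (anyᵇ-map p suc (allFin k)))

  anyᵇ-allFin-intro : ∀ k (q : Fin k → Bool) i → q i ≡ true → anyᵇ q (allFin k) ≡ true
  anyᵇ-allFin-intro (suc k) q zero e = trans (anyᵇ-suc k q) (∨-true₁ _ e)
  anyᵇ-allFin-intro (suc k) q (suc i) e = trans (anyᵇ-suc k q) (∨-true₂ (q zero) (anyᵇ-allFin-intro k (q ∘ suc) i e))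

  anyᵇ-allVecs-intro : ∀ m k (p : Vec (Fin m) k → Bool) (v : Vec (Fin m) k) → p v ≡ true → anyᵇ p (allVecs (allFin m) k) ≡ true
  anyᵇ-allVecs-intro m zero p [] e = ∨-true₁ false e
  anyᵇ-allVecs-intro m (suc k) p (a ∷ v) e =
    trans (anyᵇ-concatMap p (λ x → map (x ∷_) (allVecs (allFin m) k)) (allFin m))
    (trans (anyᵇ-cong (allFin m) (λ x → anyᵇ-map p (x ∷_) (allVecs (allFin m) k)))
    (anyᵇ-allFin-intro m _ a (anyᵇ-allVecs-intro m k (p ∘ (a ∷_)) v e)))

  anyᵇ≡occurs : ∀ {n k} (w : Fin n) (ψ : Vec (Fin n) k) → anyᵇ (λ i → lookup ψ i == w) (allFin k) ≡ occurs w ψ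
  anyᵇ≡occurs w [] = refl
  anyᵇ≡occurs {k = suc k} w (a ∷ ψ) = trans (anyᵇ-suc k (λ i → lookup (a ∷ ψ) i == w)) (cong ((a == w) ∨_) (anyᵇ≡occurs w ψ))

  ≟ᵇ-sound : ∀ {x y : Bool} → ⌊ x ≟ᵇ y ⌋ ≡ true → x ≡ y
  ≟ᵇ-sound {x} {y} e with x ≟ᵇ y
  ... | yes p = p
  ≟ᵇ-sound {x} {y} () | no _

  ≟ᵇ-complete : ∀ {x y : Bool} → x ≡ y → ⌊ x ≟ᵇ y ⌋ ≡ true
  ≟ᵇ-complete {x} {y} e with x ≟ᵇ y
  ... | yes p = refl
  ... | no ne = ⊥-elim (ne e)

  Inj : ∀ {n k} → Vec (Fin n) k → Set
  Inj {k = k} φ = ∀ (u v : Fin k) → lookup φ u ≡ lookup φ v → u ≡ v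

  true≢false : true ≢ false
  true≢false ()

  isInjective⇒Inj : ∀ {n k} (φ : Vec (Fin n) k) → isInjective φ ≡ true → Inj φ
  isInjective⇒Inj {k = k} φ e u v eq = ==-true (lem (allᵇ-true k _ (allᵇ-true k _ e u) v))
    where
    lem : (u == v) ∨ not (lookup φ u == lookup φ v) ≡ true → (u == v) ≡ true
    lem h rewrite eq | ==-refl (lookup φ v) with u == v | h
    ... | true | _ = refl

  Inj⇒isInjective : ∀ {n k} (φ : Vec (Fin n) k) → Inj φ → isInjective φ ≡ true
  Inj⇒isInjective {k = k} φ inj = allᵇ-intro k _ (λ u → allᵇ-intro k _ (λ v → lem u v))
    where
    lem : ∀ u v → (u == v) ∨ not (lookup φ u == lookup φ v) ≡ true
    lem u v with u FP.≟ v
    ... | yes _ = refl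
    ... | no ne with lookup φ u FP.≟ lookup φ v
    ... | yes q = ⊥-elim (ne (inj u v q))
    ... | no _ = refl

  occurs⇒∃ : ∀ {n k} (w : Fin n) (Ψ : Vec (Fin n) k) → occurs w Ψ ≡ true → ∃ λ j → lookup Ψ j ≡ w
  occurs⇒∃ w (a ∷ Ψ) e with a FP.≟ w
  ... | yes p = zero , p
  ... | no _ with occurs⇒∃ w Ψ e
  ... | j , q = suc j , q

  distinct⇒Inj : ∀ {n k} (φ : Vec (Fin n) k) → distinct φ ≡ true → Inj φ
  distinct⇒Inj (a ∷ Ψ) e zero zero eq = refl
  distinct⇒Inj (a ∷ Ψ) e zero (suc v) eq = ⊥-elim (true≢false (trans (sym (==-refl a)) (trans (cong (_== a) eq) (occurs-lookup-false a Ψ (not-true (∧-conicalˡ _ _ e)) v))))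
  distinct⇒Inj (a ∷ Ψ) e (suc u) zero eq = ⊥-elim (true≢false (trans (sym (==-refl a)) (trans (cong (_== a) (sym eq)) (occurs-lookup-false a Ψ (not-true (∧-conicalˡ _ _ e)) u))))
  distinct⇒Inj (a ∷ Ψ) e (suc u) (suc v) eq = cong suc (distinct⇒Inj Ψ (∧-conicalʳ _ _ e) u v eq)

  Inj⇒distinct : ∀ {n k} (φ : Vec (Fin n) k) → Inj φ → distinct φ ≡ true
  Inj⇒distinct [] inj = refl
  Inj⇒distinct (a ∷ Ψ) inj with occurs a Ψ in eqm
  ... | true = ⊥-elim (lem (inj (suc (proj₁ (occurs⇒∃ a Ψ eqm))) zero (proj₂ (occurs⇒∃ a Ψ eqm))))
    where
    lem : ∀ {k} {j : Fin k} → suc j ≢ zero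
    lem ()
  ... | false = Inj⇒distinct Ψ (λ u v eq → FP.suc-injective (inj (suc u) (suc v) eq))

  isInjective≡distinct : ∀ {n k} (φ : Vec (Fin n) k) → isInjective φ ≡ distinct φ
  isInjective≡distinct φ = bool-ext (λ e → Inj⇒distinct φ (isInjective⇒Inj φ e)) (λ e → Inj⇒isInjective φ (distinct⇒Inj φ e))

  j≡signedCount : (H G : Graph) → ι (j H G) ≡ signedCount H G
  j≡signedCount H G = begin
    ι (j H G) ≡⟨ ι-sum (filterᵇ isInjective (maps H G)) _ ⟩
    ∑ (filterᵇ isInjective (maps H G)) (λ φ → ι (sign (brokenEdges H G φ))) ≡⟨ ∑-filter isInjective (maps H G) _ ⟩
    ∑ (maps H G) (λ φ → [ isInjective φ ] * ι (sign (brokenEdges H G φ)))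
      ≡⟨ ∑-cong (maps H G) (λ φ → cong₂ _*_ (cong [_] (isInjective≡distinct φ)) (sign≡edgeMonomial H G φ)) ⟩
    signedCount H G ∎

  -- Every signedCount H is expressible with bound |V(H)|: remove isolated vertices
  -- one at a time (each giving a linear factor) until none is left, where
  -- signedCount H = j(H,·).
  signedCount-expressible : ∀ r (H : GraphOn r) → Expressible r (signedCount (toGraph H))
  signedCount-expressible zero H = expr-cong (λ G → j≡signedCount (toGraph H) G) (expr-j (toGraph H) (λ ()))
  signedCount-expressible (suc r) H with FP.all? (λ v → FP.any? (λ u → edge H v u ≟ᵇ true))
  ... | yes ni = expr-cong (λ G → j≡signedCount (toGraph H) G) (expr-j (toGraph H) ni)
  ... | no ¬ni with FP.¬∀⟶∃¬ (suc r) _ (λ v → FP.any? (λ u → edge H v u ≟ᵇ true)) ¬ni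
  ... | v , ¬e = expr-cong (λ G → sym (signedCount-isolated H v iso G)) (expr-linearFactor (toℚ r) (signedCount-expressible r (deleteVertex H v)))
    where
    iso : ∀ u → edge H v u ≡ false
    iso u with edge H v u in eq
    ... | true = ⊥-elim (¬e (u , eq))
    ... | false = refl

  Pattern : ℕ → Set
  Pattern r = Fin r → Fin r → Bool

  _≐_ : ∀ {r} → Pattern r → Pattern r → Set
  a ≐ b = ∀ u v → a u v ≡ b u v

  adjPattern : (G : Graph) → ∀ {r} → Vec (Fin (size G)) r → Pattern r
  adjPattern G Ψ u v = adj G (lookup Ψ u) (lookup Ψ v)

  bools : List Bool
  bools = true ∷ false ∷ []

  Matrices : (r : ℕ) → List (Vec (Vec Bool r) r)
  Matrices r = allVecs (allVecs bools r) r

  entry : ∀ {r} → Vec (Vec Bool r) r → Pattern r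
  entry E u v = lookup (lookup E u) v

  symmetrise : ∀ {r} → Pattern r → Pattern r
  symmetrise c u v = if ⌊ u <? v ⌋ then c u v else (if ⌊ v <? u ⌋ then c v u else false)

  symmetrise-cong : ∀ {r} {c d : Pattern r} → c ≐ d → symmetrise c ≐ symmetrise d
  symmetrise-cong e u v = cong₂ (λ x y → if ⌊ u <? v ⌋ then x else (if ⌊ v <? u ⌋ then y else false)) (e u v) (e v u)

  beq : Bool → Bool → Bool
  beq x y = if x then y else not y

  δᵇ : Bool → Bool → ℚ
  δᵇ x y = [ beq x y ]

  ∑-δᵇ : ∀ y (h : Bool → ℚ) → ∑ bools (λ x → δᵇ x y * h x) ≡ h y
  ∑-δᵇ true h = trans (cong₂ _+_ (*-identityˡ (h true)) (trans (cong (_+ 0ℚ) (*-zeroˡ (h false))) (+-identityˡ 0ℚ))) (+-identityʳ (h true))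
  ∑-δᵇ false h = trans (cong₂ _+_ (*-zeroˡ (h true)) (trans (cong (_+ 0ℚ) (*-identityˡ (h false))) (+-identityʳ (h false)))) (+-identityˡ (h false))

  δᵛ : ∀ {r} → Vec Bool r → Vec Bool r → ℚ
  δᵛ {r} x y = ∏ (allFin r) (λ v → δᵇ (lookup x v) (lookup y v))

  ∑-δᵛ : ∀ r y (h : Vec Bool r → ℚ) → ∑ (allVecs bools r) (λ x → δᵛ x y * h x) ≡ h y
  ∑-δᵛ r y h = ∑-delta-vec bools δᵇ ∑-δᵇ r y h

  ∑-delta-matrix : ∀ r (d : Pattern r) (g : Vec (Vec Bool r) r → ℚ) →
    ∑ (Matrices r) (λ c → ∏ (allFin r) (λ u → ∏ (allFin r) (λ v → δᵇ (entry c u v) (d u v))) * g c) ≡ g (tabulate λ u → tabulate λ v → d u v)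
  ∑-delta-matrix r d g = trans (∑-cong (Matrices r) (λ c → cong (_* g c) (∏-cong (allFin r) (λ u → ∏-cong (allFin r) (λ v →
      cong (δᵇ (entry c u v)) (sym (trans (cong (λ w → lookup w v) (VP.lookup∘tabulate (λ u → tabulate (d u)) u)) (VP.lookup∘tabulate (d u) v))))))))
    (∑-delta-vec (allVecs bools r) δᵛ (∑-δᵛ r) r D g)
    where D = tabulate λ u → tabulate λ v → d u v

  upper : ∀ {r} → Pattern r → Pattern r
  upper a u v = ⌊ u <? v ⌋ ∧ a u v

  symmetrise-upper : ∀ {r} (a : Pattern r) → (∀ u v → a u v ≡ a v u) → (∀ v → a v v ≡ false) → symmetrise (upper a) ≐ a
  symmetrise-upper a sy ir u v with u <? v | v <? u
  ... | yes _ | _ = refl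
  ... | no _ | yes _ = sym (sy u v)
  ... | no ¬p | no ¬q with u FP.≟ v
  ... | yes refl = sym (ir u)
  ... | no ne with FP.<-cmp u v
  ... | tri< lt _ _ = ⊥-elim (¬p lt)
  ... | tri≈ _ eq _ = ⊥-elim (ne eq)
  ... | tri> _ _ gt = ⊥-elim (¬q gt)

  -- The delta [c = b] on the upper-triangular entry b is affine in the sign of
  -- the underlying adjacency: δ(c, b) = constTerm + linTerm · spin(a).
  constTerm : ∀ {r} → Bool → Fin r → Fin r → ℚ
  constTerm c u v = if ⌊ u <? v ⌋ then ½ else [ not c ]

  linTerm : ∀ {r} → Bool → Fin r → Fin r → ℚ
  linTerm c u v = if ⌊ u <? v ⌋ then ½ * spin c else 0ℚ

  δᵇ-affine : ∀ {r} (c : Bool) (u v : Fin r) (a : Bool) → δᵇ c (⌊ u <? v ⌋ ∧ a) ≡ constTerm c u v + linTerm c u v * spin a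
  δᵇ-affine c u v a with ⌊ u <? v ⌋
  δᵇ-affine true u v true | true = refl
  δᵇ-affine true u v false | true = refl
  δᵇ-affine false u v true | true = refl
  δᵇ-affine false u v false | true = refl
  δᵇ-affine true u v a | false = sym (trans (cong (0ℚ +_) (*-zeroˡ (spin a))) refl)
  δᵇ-affine false u v a | false = sym (trans (cong (1ℚ +_) (*-zeroˡ (spin a))) refl)

  expand-binomials : ∀ r (A B : Fin r → Fin r → ℚ) →
    ∏ (allFin r) (λ u → ∏ (allFin r) (λ v → A u v + B u v)) ≡
    ∑ (Matrices r) (λ E → ∏ (allFin r) (λ u → ∏ (allFin r) (λ v → if entry E u v then B u v else A u v)))
  expand-binomials r A B = begin
    ∏ (allFin r) (λ u → ∏ (allFin r) (λ v → A u v + B u v))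
      ≡⟨ ∏-cong (allFin r) (λ u → trans (∏-cong (allFin r) (λ v → pt u v)) (∏∑-distrib bools r (λ v b → if b then B u v else A u v))) ⟩
    ∏ (allFin r) (λ u → ∑ (allVecs bools r) (λ e → ∏ (allFin r) (λ v → if lookup e v then B u v else A u v)))
      ≡⟨ ∏∑-distrib (allVecs bools r) r (λ u e → ∏ (allFin r) (λ v → if lookup e v then B u v else A u v)) ⟩
    ∑ (Matrices r) (λ E → ∏ (allFin r) (λ u → ∏ (allFin r) (λ v → if entry E u v then B u v else A u v))) ∎
    where
    pt : ∀ u v → A u v + B u v ≡ ∑ bools (λ b → if b then B u v else A u v)
    pt u v = trans (+-comm (A u v) (B u v)) (cong (B u v +_) (sym (+-identityʳ (A u v))))

  -- The coefficient of the monomial indexed by E in the expansion of the delta at c.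
  coefficient : ∀ {r} → Vec (Vec Bool r) r → Vec (Vec Bool r) r → ℚ
  coefficient {r} c E = ∏ (allFin r) (λ u → ∏ (allFin r) (λ v → if entry E u v then linTerm (entry c u v) u v else constTerm (entry c u v) u v))

  monomial : ∀ {r} → Vec (Vec Bool r) r → Pattern r → ℚ
  monomial {r} E a = ∏ (allFin r) (λ u → ∏ (allFin r) (λ v → if entry E u v then spin (a u v) else 1ℚ))

  if-split : ∀ (b : Bool) (β y α : ℚ) → (if b then β * y else α) ≡ (if b then β else α) * (if b then y else 1ℚ)
  if-split true β y α = refl
  if-split false β y α = sym (*-identityʳ α)

  -- Fourier expansion: every function R of a simple-graph pattern is a rational
  -- linear combination of edge monomials.
  pattern-expansion : ∀ r (R : Pattern r → ℚ) → (∀ a b → a ≐ b → R a ≡ R b) → (a : Pattern r) → (∀ u v → a u v ≡ a v u) → (∀ v → a v v ≡ false) →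
    R a ≡ ∑ (Matrices r) (λ c → R (symmetrise (entry c)) * ∑ (Matrices r) (λ E → coefficient c E * monomial E a))
  pattern-expansion r R fn-cong a sy ir = begin
    R a ≡⟨ fn-cong a (symmetrise (upper a)) (λ u v → sym (symmetrise-upper a sy ir u v)) ⟩
    R (symmetrise (upper a)) ≡⟨ fn-cong _ _ (symmetrise-cong (λ u v → sym (trans (cong (λ w → lookup w v) (VP.lookup∘tabulate (λ u → tabulate (upper a u)) u)) (VP.lookup∘tabulate (upper a u) v)))) ⟩
    R (symmetrise (entry (tabulate λ u → tabulate λ v → upper a u v))) ≡⟨ sym (∑-delta-matrix r (upper a) (λ c → R (symmetrise (entry c)))) ⟩
    ∑ (Matrices r) (λ c → ∏ (allFin r) (λ u → ∏ (allFin r) (λ v → δᵇ (entry c u v) (upper a u v))) * R (symmetrise (entry c)))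
      ≡⟨ ∑-cong (Matrices r) (λ c → trans (*-comm _ (R (symmetrise (entry c)))) (cong (R (symmetrise (entry c)) *_) (step c))) ⟩
    ∑ (Matrices r) (λ c → R (symmetrise (entry c)) * ∑ (Matrices r) (λ E → coefficient c E * monomial E a)) ∎
    where
    step : ∀ c → ∏ (allFin r) (λ u → ∏ (allFin r) (λ v → δᵇ (entry c u v) (upper a u v))) ≡ ∑ (Matrices r) (λ E → coefficient c E * monomial E a)
    step c = begin
      ∏ (allFin r) (λ u → ∏ (allFin r) (λ v → δᵇ (entry c u v) (upper a u v)))
        ≡⟨ ∏-cong (allFin r) (λ u → ∏-cong (allFin r) (λ v → δᵇ-affine (entry c u v) u v (a u v))) ⟩
      ∏ (allFin r) (λ u → ∏ (allFin r) (λ v → constTerm (entry c u v) u v + linTerm (entry c u v) u v * spin (a u v)))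
        ≡⟨ expand-binomials r (λ u v → constTerm (entry c u v) u v) (λ u v → linTerm (entry c u v) u v * spin (a u v)) ⟩
      ∑ (Matrices r) (λ E → ∏ (allFin r) (λ u → ∏ (allFin r) (λ v → if entry E u v then linTerm (entry c u v) u v * spin (a u v) else constTerm (entry c u v) u v)))
        ≡⟨ ∑-cong (Matrices r) (λ E → trans (∏-cong (allFin r) (λ u → trans (∏-cong (allFin r) (λ v → if-split (entry E u v) (linTerm (entry c u v) u v) (spin (a u v)) (constTerm (entry c u v) u v)))
              (∏-* (allFin r) (λ v → if entry E u v then linTerm (entry c u v) u v else constTerm (entry c u v) u v) (λ v → if entry E u v then spin (a u v) else 1ℚ))))
              (∏-* (allFin r) (λ u → ∏ (allFin r) (λ v → if entry E u v then linTerm (entry c u v) u v else constTerm (entry c u v) u v)) (λ u → ∏ (allFin r) (λ v → if entry E u v then spin (a u v) else 1ℚ)))) ⟩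
      ∑ (Matrices r) (λ E → coefficient c E * monomial E a) ∎

  symmetrise-sym : ∀ {r} (c : Pattern r) u v → symmetrise c u v ≡ symmetrise c v u
  symmetrise-sym c u v with u <? v | v <? u
  ... | yes p | yes q = ⊥-elim (FP.<-asym p q)
  ... | yes p | no _ = refl
  ... | no _ | yes q = refl
  ... | no _ | no _ = refl

  symmetrise-irrefl : ∀ {r} (c : Pattern r) v → symmetrise c v v ≡ false
  symmetrise-irrefl c v with v <? v
  ... | yes p = ⊥-elim (FP.<-irrefl refl p)
  ... | no _ = refl

  graphOfMatrix : ∀ {r} → Vec (Vec Bool r) r → GraphOn r
  graphOfMatrix E = record { edge = symmetrise (entry E) ; edge-sym = symmetrise-sym (entry E) ; edge-irrefl = symmetrise-irrefl (entry E) }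


  ite-false : ∀ x (a : ℚ) → (if x ∧ false then a else 1ℚ) ≡ 1ℚ
  ite-false true a = refl
  ite-false false a = refl

  monomial≡edgeMonomial : ∀ {r} (E : Vec (Vec Bool r) r) → (∀ u v → entry E u v ≡ true → u F.< v) →
    (G : Graph) (Ψ : Vec (Fin (size G)) r) → monomial E (adjPattern G Ψ) ≡ edgeMonomial (toGraph (graphOfMatrix E)) G Ψ
  monomial≡edgeMonomial {r} E up G Ψ = ∏-cong (allFin r) (λ u → ∏-cong (allFin r) (λ v → pt u v))
    where
    pt : ∀ u v → (if entry E u v then spin (adjPattern G Ψ u v) else 1ℚ) ≡ (if symmetrise (entry E) u v ∧ ⌊ u <? v ⌋ then spin (adjPattern G Ψ u v) else 1ℚ)
    pt u v with u <? v
    ... | yes p = cong (λ b → if b then spin (adjPattern G Ψ u v) else 1ℚ) (sym (∧-identityʳ (entry E u v)))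
    ... | no ¬p with entry E u v in eq
    ... | true = ⊥-elim (¬p (up u v eq))
    ... | false = sym (ite-false (if ⌊ v <? u ⌋ then entry E v u else false) (spin (adjPattern G Ψ u v)))

  ∏-zero : ∀ r (f : Fin r → ℚ) (u : Fin r) → f u ≡ 0ℚ → ∏ (allFin r) f ≡ 0ℚ
  ∏-zero (suc r) f u e = trans (∏-allFin-punchIn r u f) (trans (cong (_* ∏ (allFin r) (f ∘ punchIn u)) e) (*-zeroˡ (∏ (allFin r) (f ∘ punchIn u))))

  coefficient-lower : ∀ {r} (c E : Vec (Vec Bool r) r) u v → entry E u v ≡ true → ¬ (u F.< v) → coefficient c E ≡ 0ℚ
  coefficient-lower {r} c E u v e nlt = ∏-zero r (λ u → ∏ (allFin r) (λ v → if entry E u v then linTerm (entry c u v) u v else constTerm (entry c u v) u v)) u (∏-zero r (λ v → if entry E u v then linTerm (entry c u v) u v else constTerm (entry c u v) u v) v lem)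
    where
    lem : (if entry E u v then linTerm (entry c u v) u v else constTerm (entry c u v) u v) ≡ 0ℚ
    lem rewrite e with u <? v
    ... | yes p = ⊥-elim (nlt p)
    ... | no _ = refl

  upper? : ∀ {r} (E : Vec (Vec Bool r) r) u v → Dec (entry E u v ≡ true → u F.< v)
  upper? E u v with entry E u v
  ... | false = yes (λ ())
  ... | true with u <? v
  ... | yes p = yes (λ _ → p)
  ... | no ¬p = no (λ f → ¬p (f refl))

  -- Each monomial summed over injective tuples is expressible: it is zero or a
  -- signedCount.
  monomialSum-expressible : ∀ r (c E : Vec (Vec Bool r) r) → Expressible r (λ G → coefficient c E * ∑ (Tuples (size G) r) (λ Ψ → [ distinct Ψ ] * monomial E (adjPattern G Ψ)))
  monomialSum-expressible r c E with FP.all? (λ u → FP.all? (λ v → upper? E u v))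
  ... | yes up = expr-cong (λ G → cong (coefficient c E *_) (∑-cong (Tuples (size G) r) (λ Ψ → cong ([ distinct Ψ ] *_) (sym (monomial≡edgeMonomial E up G Ψ)))))
                  (expr-scale (coefficient c E) (signedCount-expressible r (graphOfMatrix E)))
  ... | no ¬up with FP.¬∀⟶∃¬ r _ (λ u → FP.all? (λ v → upper? E u v)) ¬up
  ... | u , ¬u with FP.¬∀⟶∃¬ r _ (upper? E u) ¬u
  ... | v , ¬uv = expr-cong (λ G → sym (trans (cong (_* S G) (coefficient-lower c E u v e1 e2)) (*-zeroˡ (S G)))) expr-zero
    where
    e1 : entry E u v ≡ true
    e1 with entry E u v
    ... | true = refl
    ... | false = ⊥-elim (¬uv (λ ()))
    e2 : ¬ (u F.< v)
    e2 lt = ¬uv (λ _ → lt)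
    S : Graph → ℚ
    S G = ∑ (Tuples (size G) r) (λ Ψ → [ distinct Ψ ] * monomial E (adjPattern G Ψ))

  injectiveSum-expressible : ∀ r (R : Pattern r → ℚ) → (∀ a b → a ≐ b → R a ≡ R b) →
    Expressible r (λ G → ∑ (Tuples (size G) r) (λ Ψ → [ distinct Ψ ] * R (adjPattern G Ψ)))
  injectiveSum-expressible r R fn-cong = expr-cong (λ G → sym (main G))
    (expr-∑ (Matrices r) (λ c → expr-∑ (Matrices r) (λ E → expr-cong (λ G → sym (*-assoc (R (symmetrise (entry c))) (coefficient c E) _)) (expr-scale (R (symmetrise (entry c))) (monomialSum-expressible r c E)))))
    where
    main : ∀ G → ∑ (Tuples (size G) r) (λ Ψ → [ distinct Ψ ] * R (adjPattern G Ψ)) ≡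
      ∑ (Matrices r) (λ c → ∑ (Matrices r) (λ E → (R (symmetrise (entry c)) * coefficient c E) * ∑ (Tuples (size G) r) (λ Ψ → [ distinct Ψ ] * monomial E (adjPattern G Ψ))))
    main G = begin
      ∑ TT (λ Ψ → [ distinct Ψ ] * R (adjPattern G Ψ))
        ≡⟨ ∑-cong TT (λ Ψ → cong ([ distinct Ψ ] *_) (pattern-expansion r R fn-cong (adjPattern G Ψ) (λ u v → Graph.sym G _ _) (λ v → Graph.irrefl G _))) ⟩
      ∑ TT (λ Ψ → [ distinct Ψ ] * ∑ (Matrices r) (λ c → R (symmetrise (entry c)) * ∑ (Matrices r) (λ E → coefficient c E * monomial E (adjPattern G Ψ))))
        ≡⟨ ∑-cong TT (λ Ψ → trans (∑-*ˡ (Matrices r) [ distinct Ψ ] _) (∑-cong (Matrices r) (λ c →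
             trans (cong ([ distinct Ψ ] *_) (∑-*ˡ (Matrices r) (R (symmetrise (entry c))) _)) (trans (∑-*ˡ (Matrices r) [ distinct Ψ ] _)
             (∑-cong (Matrices r) (λ E → solve 4 (λ i x y z → i :* (x :* (y :* z)) := (x :* y) :* (i :* z)) refl [ distinct Ψ ] (R (symmetrise (entry c))) (coefficient c E) (monomial E (adjPattern G Ψ)))))))) ⟩
      ∑ TT (λ Ψ → ∑ (Matrices r) (λ c → ∑ (Matrices r) (λ E → (R (symmetrise (entry c)) * coefficient c E) * ([ distinct Ψ ] * monomial E (adjPattern G Ψ)))))
        ≡⟨ ∑-swap TT (Matrices r) _ ⟩
      ∑ (Matrices r) (λ c → ∑ TT (λ Ψ → ∑ (Matrices r) (λ E → (R (symmetrise (entry c)) * coefficient c E) * ([ distinct Ψ ] * monomial E (adjPattern G Ψ)))))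
        ≡⟨ ∑-cong (Matrices r) (λ c → ∑-swap TT (Matrices r) _) ⟩
      ∑ (Matrices r) (λ c → ∑ (Matrices r) (λ E → ∑ TT (λ Ψ → (R (symmetrise (entry c)) * coefficient c E) * ([ distinct Ψ ] * monomial E (adjPattern G Ψ)))))
        ≡⟨ ∑-cong (Matrices r) (λ c → ∑-cong (Matrices r) (λ E → sym (∑-*ˡ TT (R (symmetrise (entry c)) * coefficient c E) _))) ⟩
      ∑ (Matrices r) (λ c → ∑ (Matrices r) (λ E → (R (symmetrise (entry c)) * coefficient c E) * ∑ TT (λ Ψ → [ distinct Ψ ] * monomial E (adjPattern G Ψ)))) ∎
      where TT = Tuples (size G) r

  record PatternFn (r : ℕ) : Set where
    field
      fn : Pattern r → Pattern r → ℚ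
      fn-cong : ∀ {e e' a a'} → e ≐ e' → a ≐ a' → fn e a ≡ fn e' a'
  open PatternFn public

  _∘ᵖ_ : ∀ {r s} → Pattern s → (Fin r → Fin s) → Pattern r
  (e ∘ᵖ σ) u v = e (σ u) (σ v)

  reindex : ∀ {r s} → (Fin r → Fin s) → PatternFn r → PatternFn s
  reindex σ Q = record { fn = λ e a → fn Q (e ∘ᵖ σ) (a ∘ᵖ σ) ; fn-cong = λ ee aa → fn-cong Q (λ u v → ee (σ u) (σ v)) (λ u v → aa (σ u) (σ v)) }

  eqPattern : ∀ {n r} → Vec (Fin n) r → Pattern r
  eqPattern Ψ u v = lookup Ψ u == lookup Ψ v

  evalAt : ∀ {r} → PatternFn r → (G : Graph) → Vec (Fin (size G)) r → ℚ
  evalAt Q G Ψ = fn Q (eqPattern Ψ) (adjPattern G Ψ)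

  evalAt-reindex : ∀ {r s} (Q : PatternFn r) (G : Graph) (Ψ : Vec (Fin (size G)) r) (Φ : Vec (Fin (size G)) s) (σ : Fin r → Fin s) →
    (∀ u → lookup Φ (σ u) ≡ lookup Ψ u) → evalAt (reindex σ Q) G Φ ≡ evalAt Q G Ψ
  evalAt-reindex Q G Ψ Φ σ h = fn-cong Q (λ u v → cong₂ _==_ (h u) (h v)) (λ u v → cong₂ (adj G) (h u) (h v))

  disjoint : ∀ {n p q} → Vec (Fin n) p → Vec (Fin n) q → Bool
  disjoint Ψ1 Ψ2 = allV (λ x → not (occurs x Ψ2)) Ψ1

  disjoint-[] : ∀ {n p} (Ψ1 : Vec (Fin n) p) → disjoint Ψ1 [] ≡ true
  disjoint-[] [] = refl
  disjoint-[] (x ∷ Ψ1) = disjoint-[] Ψ1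

  disjoint-∷ : ∀ {n p q} (a : Fin n) (Ψ1 : Vec (Fin n) p) (Ψ2 : Vec (Fin n) q) → disjoint Ψ1 (a ∷ Ψ2) ≡ not (occurs a Ψ1) ∧ disjoint Ψ1 Ψ2
  disjoint-∷ a [] Ψ2 = refl
  disjoint-∷ a (x ∷ Ψ1) Ψ2 = begin
    not ((a == x) ∨ occurs x Ψ2) ∧ disjoint Ψ1 (a ∷ Ψ2) ≡⟨ cong₂ (λ y z → not (y ∨ occurs x Ψ2) ∧ z) (==-sym a x) (disjoint-∷ a Ψ1 Ψ2) ⟩
    not ((x == a) ∨ occurs x Ψ2) ∧ (not (occurs a Ψ1) ∧ disjoint Ψ1 Ψ2) ≡⟨ not∨-∧-swap (x == a) (occurs x Ψ2) (occurs a Ψ1) (disjoint Ψ1 Ψ2) ⟩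
    not ((x == a) ∨ occurs a Ψ1) ∧ (not (occurs x Ψ2) ∧ disjoint Ψ1 Ψ2) ∎

  disjoint-lookup : ∀ {n p q} (Ψ1 : Vec (Fin n) p) (Ψ2 : Vec (Fin n) q) i → disjoint Ψ1 Ψ2 ≡ true → occurs (lookup Ψ1 i) Ψ2 ≡ false
  disjoint-lookup Ψ1 Ψ2 i e = not-true (allV-lookup _ Ψ1 e i)

  -- First occurrence read off the equality pattern, so that pattern functions can
  -- use it.
  firstOccᵖ : ∀ {p} → Pattern p → Fin p → Bool
  firstOccᵖ {suc p} e zero = true
  firstOccᵖ {suc p} e (suc i) = not (e zero (suc i)) ∧ firstOccᵖ (λ x y → e (suc x) (suc y)) i

  firstOccᵖ-cong : ∀ {p} {e e' : Pattern p} → e ≐ e' → ∀ i → firstOccᵖ e i ≡ firstOccᵖ e' i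
  firstOccᵖ-cong {suc p} h zero = refl
  firstOccᵖ-cong {suc p} h (suc i) = cong₂ (λ x y → not x ∧ y) (h zero (suc i)) (firstOccᵖ-cong (λ x y → h (suc x) (suc y)) i)

  firstOcc≡firstOccᵖ : ∀ {n p} (Ψ : Vec (Fin n) p) i → firstOcc Ψ i ≡ firstOccᵖ (eqPattern Ψ) i
  firstOcc≡firstOccᵖ (a ∷ Ψ) zero = refl
  firstOcc≡firstOccᵖ (a ∷ Ψ) (suc i) = cong (not (a == lookup Ψ i) ∧_) (firstOcc≡firstOccᵖ Ψ i)

  -- Position maps: moveHead moves the head of the left block to the front of the
  -- right block; dupHead makes the head a copy of position i of the left block.
  moveHead : ∀ p q → Fin (suc (p ℕ.+ q)) → Fin (p ℕ.+ suc q)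
  moveHead zero q k = k
  moveHead (suc p) q zero = suc (moveHead p q zero)
  moveHead (suc p) q (suc zero) = zero
  moveHead (suc p) q (suc (suc k)) = suc (moveHead p q (suc k))

  moveHead-lookup : ∀ {A : Set} {p q} (a : A) (Ψ1 : Vec A p) (Ψ2 : Vec A q) k → lookup (Ψ1 ++ (a ∷ Ψ2)) (moveHead p q k) ≡ lookup ((a ∷ Ψ1) ++ Ψ2) k
  moveHead-lookup a [] Ψ2 k = refl
  moveHead-lookup a (b ∷ Ψ1) Ψ2 zero = moveHead-lookup a Ψ1 Ψ2 zero
  moveHead-lookup a (b ∷ Ψ1) Ψ2 (suc zero) = refl
  moveHead-lookup a (b ∷ Ψ1) Ψ2 (suc (suc k)) = moveHead-lookup a Ψ1 Ψ2 (suc k)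

  dupHead : ∀ p q → Fin p → Fin (suc (p ℕ.+ q)) → Fin (p ℕ.+ q)
  dupHead p q i zero = i ↑ˡ q
  dupHead p q i (suc k) = k

  dupHead-lookup : ∀ {A : Set} {p q} (Ψ1 : Vec A p) (Ψ2 : Vec A q) i k → lookup (Ψ1 ++ Ψ2) (dupHead p q i k) ≡ lookup ((lookup Ψ1 i ∷ Ψ1) ++ Ψ2) k
  dupHead-lookup Ψ1 Ψ2 i zero = VP.lookup-++ˡ Ψ1 Ψ2 i
  dupHead-lookup Ψ1 Ψ2 i (suc k) = refl

  -- For p = 0 it is a sum over injective
  -- tuples; for q = 0 it is the full tuple sum.
  disjointSum : ∀ p q → PatternFn (p ℕ.+ q) → Graph → ℚ
  disjointSum p q Q G = ∑ (Tuples (size G) p) (λ Ψ1 → ∑ (Tuples (size G) q) (λ Ψ2 → [ distinct Ψ2 ] * [ disjoint Ψ1 Ψ2 ] * evalAt Q G (Ψ1 ++ Ψ2)))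

  diagonal : ∀ {r} → Pattern r
  diagonal u v = u == v

  eqPattern-distinct : ∀ {n r} (Ψ : Vec (Fin n) r) → distinct Ψ ≡ true → eqPattern Ψ ≐ diagonal
  eqPattern-distinct Ψ e u v with u FP.≟ v
  ... | yes refl = ==-refl (lookup Ψ u)
  ... | no ne = ==-false (λ eq → ne (distinct⇒Inj Ψ e u v eq))

  disjoint-absorbs : ∀ {n p q} (Ψ1 : Vec (Fin n) p) (Ψ2 : Vec (Fin n) q) i → not (occurs (lookup Ψ1 i) Ψ2) ∧ disjoint Ψ1 Ψ2 ≡ disjoint Ψ1 Ψ2
  disjoint-absorbs Ψ1 Ψ2 i with disjoint Ψ1 Ψ2 in e
  ... | true rewrite disjoint-lookup Ψ1 Ψ2 i e = refl
  ... | false = ∧-zeroʳ _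

  ∑³-+ : ∀ {A B C : Set} (xs : List A) (ys : List B) (zs : List C) (f g : A → B → C → ℚ) →
    ∑ xs (λ a → ∑ ys (λ b → ∑ zs (λ c → f a b c + g a b c))) ≡ ∑ xs (λ a → ∑ ys (λ b → ∑ zs (λ c → f a b c))) + ∑ xs (λ a → ∑ ys (λ b → ∑ zs (λ c → g a b c)))
  ∑³-+ xs ys zs f g = trans (∑-cong xs (λ a → trans (∑-cong ys (λ b → ∑-+ zs (f a b) (g a b))) (∑-+ ys _ _))) (∑-+ xs _ _)

  -- Q restricted to tuples whose head repeats position i (at its first occurrence).
  identifyHead : ∀ p q → Fin p → PatternFn (suc (p ℕ.+ q)) → PatternFn (p ℕ.+ q)
  identifyHead p q i Q = record
    { fn = λ e a → [ firstOccᵖ (e ∘ᵖ (_↑ˡ q)) i ] * fn (reindex (dupHead p q i) Q) e a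
    ; fn-cong = λ ee aa → cong₂ _*_ (cong [_] (firstOccᵖ-cong (λ x y → ee (x ↑ˡ q) (y ↑ˡ q)) i)) (fn-cong (reindex (dupHead p q i) Q) ee aa) }

  headSummand : ∀ p q → PatternFn (suc p ℕ.+ q) → (G : Graph) →
    Fin (size G) → Vec (Fin (size G)) p → Vec (Fin (size G)) q → ℚ
  headSummand p q Q G a Ψ1 Ψ2 = [ distinct Ψ2 ] * [ not (occurs a Ψ2) ∧ disjoint Ψ1 Ψ2 ] * evalAt Q G ((a ∷ Ψ1) ++ Ψ2)

  -- Heads that occur again in the left block: grouping them by the position of the
  -- first occurrence gives disjoint sums of arity p + q.
  repeatedHead-sum : ∀ p q (Q : PatternFn (suc p ℕ.+ q)) (G : Graph) →
    ∑ (allFin (size G)) (λ a → ∑ (Tuples (size G) p) (λ Ψ1 → ∑ (Tuples (size G) q) (λ Ψ2 → [ occurs a Ψ1 ] * headSummand p q Q G a Ψ1 Ψ2)))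
      ≡ ∑ (allFin p) (λ i → disjointSum p q (identifyHead p q i Q) G)
  repeatedHead-sum p q Q G = begin
    ∑ VV (λ a → ∑ (Tuples n p) (λ Ψ1 → ∑ (Tuples n q) (λ Ψ2 → [ occurs a Ψ1 ] * S a Ψ1 Ψ2))) ≡⟨ ∑-swap VV (Tuples n p) _ ⟩
    ∑ (Tuples n p) (λ Ψ1 → ∑ VV (λ a → ∑ (Tuples n q) (λ Ψ2 → [ occurs a Ψ1 ] * S a Ψ1 Ψ2))) ≡⟨ ∑-cong (Tuples n p) (λ Ψ1 → ∑-swap VV (Tuples n q) _) ⟩
    ∑ (Tuples n p) (λ Ψ1 → ∑ (Tuples n q) (λ Ψ2 → ∑ VV (λ a → [ occurs a Ψ1 ] * S a Ψ1 Ψ2)))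
      ≡⟨ ∑-cong (Tuples n p) (λ Ψ1 → ∑-cong (Tuples n q) (λ Ψ2 → trans (∑-occurs n p Ψ1 (λ a → S a Ψ1 Ψ2)) (∑-cong (allFin p) (λ i → firstOcc-term i Ψ1 Ψ2)))) ⟩
    ∑ (Tuples n p) (λ Ψ1 → ∑ (Tuples n q) (λ Ψ2 → ∑ (allFin p) (λ i → Z i Ψ1 Ψ2))) ≡⟨ ∑-cong (Tuples n p) (λ Ψ1 → ∑-swap (Tuples n q) (allFin p) _) ⟩
    ∑ (Tuples n p) (λ Ψ1 → ∑ (allFin p) (λ i → ∑ (Tuples n q) (λ Ψ2 → Z i Ψ1 Ψ2))) ≡⟨ ∑-swap (Tuples n p) (allFin p) _ ⟩
    ∑ (allFin p) (λ i → disjointSum p q (identifyHead p q i Q) G) ∎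
    where
    n = size G
    VV = allFin n
    S = headSummand p q Q G
    Z : Fin p → Vec (Fin n) p → Vec (Fin n) q → ℚ
    Z i Ψ1 Ψ2 = [ distinct Ψ2 ] * [ disjoint Ψ1 Ψ2 ] * evalAt (identifyHead p q i Q) G (Ψ1 ++ Ψ2)
    -- The head equals Ψ1[i] at its first occurrence i: this is the summand of identifyHead i.
    firstOcc-term : ∀ i Ψ1 Ψ2 → [ firstOcc Ψ1 i ] * S (lookup Ψ1 i) Ψ1 Ψ2 ≡ Z i Ψ1 Ψ2
    firstOcc-term i Ψ1 Ψ2 = begin
      [ firstOcc Ψ1 i ] * ([ distinct Ψ2 ] * [ not (occurs (lookup Ψ1 i) Ψ2) ∧ disjoint Ψ1 Ψ2 ] * evalAt Q G ((lookup Ψ1 i ∷ Ψ1) ++ Ψ2))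
        ≡⟨ cong₂ (λ x y → [ x ] * ([ distinct Ψ2 ] * [ y ] * evalAt Q G ((lookup Ψ1 i ∷ Ψ1) ++ Ψ2))) (trans (firstOcc≡firstOccᵖ Ψ1 i) (firstOccᵖ-cong (λ x y → sym (cong₂ _==_ (VP.lookup-++ˡ Ψ1 Ψ2 x) (VP.lookup-++ˡ Ψ1 Ψ2 y))) i)) (disjoint-absorbs Ψ1 Ψ2 i) ⟩
      [ f ] * ([ distinct Ψ2 ] * [ disjoint Ψ1 Ψ2 ] * evalAt Q G ((lookup Ψ1 i ∷ Ψ1) ++ Ψ2))
        ≡⟨ cong (λ z → [ f ] * ([ distinct Ψ2 ] * [ disjoint Ψ1 Ψ2 ] * z)) (sym (evalAt-reindex Q G ((lookup Ψ1 i ∷ Ψ1) ++ Ψ2) (Ψ1 ++ Ψ2) (dupHead p q i) (dupHead-lookup Ψ1 Ψ2 i))) ⟩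
      [ f ] * ([ distinct Ψ2 ] * [ disjoint Ψ1 Ψ2 ] * evalAt (reindex (dupHead p q i) Q) G (Ψ1 ++ Ψ2))
        ≡⟨ solve 4 (λ f x y z → f :* (x :* y :* z) := x :* y :* (f :* z)) refl [ f ] [ distinct Ψ2 ] [ disjoint Ψ1 Ψ2 ] (evalAt (reindex (dupHead p q i) Q) G (Ψ1 ++ Ψ2)) ⟩
      Z i Ψ1 Ψ2 ∎
      where f = firstOccᵖ (eqPattern (Ψ1 ++ Ψ2) ∘ᵖ (_↑ˡ q)) i

  -- Heads that do not occur again in the left block join the distinct right block.
  freshHead-sum : ∀ p q (Q : PatternFn (suc p ℕ.+ q)) (G : Graph) →
    ∑ (allFin (size G)) (λ a → ∑ (Tuples (size G) p) (λ Ψ1 → ∑ (Tuples (size G) q) (λ Ψ2 → [ not (occurs a Ψ1) ] * headSummand p q Q G a Ψ1 Ψ2)))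
      ≡ disjointSum p (suc q) (reindex (moveHead p q) Q) G
  freshHead-sum p q Q G = begin
    ∑ VV (λ a → ∑ (Tuples n p) (λ Ψ1 → ∑ (Tuples n q) (λ Ψ2 → [ not (occurs a Ψ1) ] * headSummand p q Q G a Ψ1 Ψ2)))
      ≡⟨ ∑-cong VV (λ a → ∑-cong (Tuples n p) (λ Ψ1 → ∑-cong (Tuples n q) (λ Ψ2 → moved-term a Ψ1 Ψ2))) ⟩
    ∑ VV (λ a → ∑ (Tuples n p) (λ Ψ1 → ∑ (Tuples n q) (λ Ψ2 → T Ψ1 (a ∷ Ψ2)))) ≡⟨ ∑-swap VV (Tuples n p) _ ⟩
    ∑ (Tuples n p) (λ Ψ1 → ∑ VV (λ a → ∑ (Tuples n q) (λ Ψ2 → T Ψ1 (a ∷ Ψ2)))) ≡⟨ ∑-cong (Tuples n p) (λ Ψ1 → sym (∑-allVecs-suc VV q (T Ψ1))) ⟩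
    disjointSum p (suc q) Q' G ∎
    where
    n = size G
    VV = allFin n
    Q' = reindex (moveHead p q) Q
    T : Vec (Fin n) p → Vec (Fin n) (suc q) → ℚ
    T Ψ1 Ψ2 = [ distinct Ψ2 ] * [ disjoint Ψ1 Ψ2 ] * evalAt Q' G (Ψ1 ++ Ψ2)
    cong₃ : ∀ {A B C D : Set} (f : A → B → C → D) {x x' y y' z z'} → x ≡ x' → y ≡ y' → z ≡ z' → f x y z ≡ f x' y' z'
    cong₃ f refl refl refl = refl
    moved-term : ∀ a Ψ1 Ψ2 → [ not (occurs a Ψ1) ] * headSummand p q Q G a Ψ1 Ψ2 ≡ T Ψ1 (a ∷ Ψ2)
    moved-term a Ψ1 Ψ2 = begin
      [ not (occurs a Ψ1) ] * ([ distinct Ψ2 ] * [ not (occurs a Ψ2) ∧ disjoint Ψ1 Ψ2 ] * evalAt Q G ((a ∷ Ψ1) ++ Ψ2))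
        ≡⟨ cong (λ z → [ not (occurs a Ψ1) ] * ([ distinct Ψ2 ] * z * evalAt Q G ((a ∷ Ψ1) ++ Ψ2))) ([∧] (not (occurs a Ψ2)) (disjoint Ψ1 Ψ2)) ⟩
      [ not (occurs a Ψ1) ] * ([ distinct Ψ2 ] * ([ not (occurs a Ψ2) ] * [ disjoint Ψ1 Ψ2 ]) * evalAt Q G ((a ∷ Ψ1) ++ Ψ2))
        ≡⟨ solve 5 (λ m i nm d e → m :* (i :* (nm :* d) :* e) := (nm :* i) :* (m :* d) :* e) refl [ not (occurs a Ψ1) ] [ distinct Ψ2 ] [ not (occurs a Ψ2) ] [ disjoint Ψ1 Ψ2 ] (evalAt Q G ((a ∷ Ψ1) ++ Ψ2)) ⟩
      ([ not (occurs a Ψ2) ] * [ distinct Ψ2 ]) * ([ not (occurs a Ψ1) ] * [ disjoint Ψ1 Ψ2 ]) * evalAt Q G ((a ∷ Ψ1) ++ Ψ2)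
        ≡⟨ cong₃ (λ x y z → x * y * z) (sym ([∧] (not (occurs a Ψ2)) (distinct Ψ2))) (trans (sym ([∧] (not (occurs a Ψ1)) (disjoint Ψ1 Ψ2))) (cong [_] (sym (disjoint-∷ a Ψ1 Ψ2)))) (sym (evalAt-reindex Q G ((a ∷ Ψ1) ++ Ψ2) (Ψ1 ++ (a ∷ Ψ2)) (moveHead p q) (moveHead-lookup a Ψ1 Ψ2))) ⟩
      T Ψ1 (a ∷ Ψ2) ∎

  disjointSum-step : ∀ p q (Q : PatternFn (suc p ℕ.+ q)) (G : Graph) →
    disjointSum (suc p) q Q G ≡ ∑ (allFin p) (λ i → disjointSum p q (identifyHead p q i Q) G) + disjointSum p (suc q) (reindex (moveHead p q) Q) G
  disjointSum-step p q Q G = begin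
    disjointSum (suc p) q Q G ≡⟨ ∑-allVecs-suc VV p _ ⟩
    ∑ VV (λ a → ∑ (Tuples n p) (λ Ψ1 → ∑ (Tuples n q) (λ Ψ2 → S a Ψ1 Ψ2)))
      ≡⟨ ∑-cong VV (λ a → ∑-cong (Tuples n p) (λ Ψ1 → ∑-cong (Tuples n q) (λ Ψ2 → split-by (occurs a Ψ1) (S a Ψ1 Ψ2)))) ⟩
    ∑ VV (λ a → ∑ (Tuples n p) (λ Ψ1 → ∑ (Tuples n q) (λ Ψ2 → [ occurs a Ψ1 ] * S a Ψ1 Ψ2 + [ not (occurs a Ψ1) ] * S a Ψ1 Ψ2)))
      ≡⟨ ∑³-+ VV (Tuples n p) (Tuples n q) (λ a Ψ1 Ψ2 → [ occurs a Ψ1 ] * S a Ψ1 Ψ2) (λ a Ψ1 Ψ2 → [ not (occurs a Ψ1) ] * S a Ψ1 Ψ2) ⟩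
    split (λ b → [ b ]) + split (λ b → [ not b ]) ≡⟨ cong₂ _+_ (repeatedHead-sum p q Q G) (freshHead-sum p q Q G) ⟩
    ∑ (allFin p) (λ i → disjointSum p q (identifyHead p q i Q) G) + disjointSum p (suc q) (reindex (moveHead p q) Q) G ∎
    where
    n = size G
    VV = allFin n
    S = headSummand p q Q G
    split : (Bool → ℚ) → ℚ
    split χ = ∑ VV (λ a → ∑ (Tuples n p) (λ Ψ1 → ∑ (Tuples n q) (λ Ψ2 → χ (occurs a Ψ1) * S a Ψ1 Ψ2)))

  disjointSum-base : ∀ q (Q : PatternFn q) (G : Graph) →
    disjointSum zero q Q G ≡ ∑ (Tuples (size G) q) (λ Ψ → [ distinct Ψ ] * fn Q diagonal (adjPattern G Ψ))
  disjointSum-base q Q G = trans (∑-allVecs-zero (allFin (size G)) (λ Ψ1 → ∑ (Tuples (size G) q) (λ Ψ2 → [ distinct Ψ2 ] * [ disjoint Ψ1 Ψ2 ] * evalAt Q G (Ψ1 ++ Ψ2)))) (∑-cong (Tuples (size G) q) (λ Ψ →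
    trans (cong (_* evalAt Q G Ψ) (*-identityʳ [ distinct Ψ ]))
          (indicator-cong (distinct Ψ) (evalAt Q G Ψ) (fn Q diagonal (adjPattern G Ψ)) (λ e → fn-cong Q (eqPattern-distinct Ψ e) (λ _ _ → refl)))))

  -- Every disjointSum p q Q is expressible with bound p + q, by induction on the
  -- left block: the repeated heads lower the arity, the fresh head moves right.
  disjointSum-expressible : ∀ p q (Q : PatternFn (p ℕ.+ q)) → Expressible (p ℕ.+ q) (disjointSum p q Q)
  disjointSum-expressible zero q Q =
    expr-cong (λ G → sym (disjointSum-base q Q G)) (injectiveSum-expressible q (fn Q diagonal) (λ a b h → fn-cong Q (λ _ _ → refl) h))
  disjointSum-expressible (suc p) q Q = expr-cong (λ G → sym (disjointSum-step p q Q G))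
    (expr-+ (expr-weaken (ℕP.n≤1+n (p ℕ.+ q)) (expr-∑ (allFin p) (λ i → disjointSum-expressible p q (identifyHead p q i Q))))
            (subst (λ b → Expressible b (disjointSum p (suc q) Q')) (ℕP.+-suc p q) (disjointSum-expressible p (suc q) Q')))
    where Q' = reindex (moveHead p q) Q

  tupleSum-expressible : ∀ r (Q0 : PatternFn r) → Expressible r (λ G → ∑ (Tuples (size G) r) (λ Ψ → evalAt Q0 G Ψ))
  tupleSum-expressible r Q0 = subst (λ b → Expressible b (λ G → ∑ (Tuples (size G) r) (λ Ψ → evalAt Q0 G Ψ))) (ℕP.+-identityʳ r)
    (expr-cong (λ G → eq G) (disjointSum-expressible r zero Q))
    where
    Q : PatternFn (r ℕ.+ zero)
    Q = reindex (_↑ˡ zero) Q0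
    eq : ∀ G → disjointSum r zero Q G ≡ ∑ (Tuples (size G) r) (λ Ψ → evalAt Q0 G Ψ)
    eq G = ∑-cong (Tuples (size G) r) (λ Ψ1 → trans (∑-allVecs-zero (allFin (size G)) (λ Ψ2 → [ distinct Ψ2 ] * [ disjoint Ψ1 Ψ2 ] * evalAt Q G (Ψ1 ++ Ψ2)))
      (trans (cong (λ b → 1ℚ * [ b ] * evalAt Q G (Ψ1 ++ [])) (disjoint-[] Ψ1))
      (trans (trans (cong (_* evalAt Q G (Ψ1 ++ [])) (*-identityˡ 1ℚ)) (*-identityˡ (evalAt Q G (Ψ1 ++ []))))
        (evalAt-reindex Q0 G Ψ1 (Ψ1 ++ []) (_↑ˡ zero) (λ u → VP.lookup-++ˡ Ψ1 [] u)))))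

  toℚ-countᵇ : ∀ {A : Set} (p : A → Bool) (xs : List A) → toℚ (countᵇ p xs) ≡ ∑ xs (λ x → [ p x ])
  toℚ-countᵇ p [] = refl
  toℚ-countᵇ p (x ∷ xs) with p x
  ... | true = trans (toℚ-suc (countᵇ p xs)) (cong (1ℚ +_) (toℚ-countᵇ p xs))
  ... | false = trans (toℚ-countᵇ p xs) (sym (+-identityˡ _))

  toℚ-injective : ∀ {a b} → toℚ a ≡ toℚ b → a ≡ b
  toℚ-injective {a} {b} e = ℤP.+-injective (trans (sym (cong ℚ.↥_ (ι-mkℚ (ℤ.+ a)))) (trans (cong ℚ.↥_ e) (cong ℚ.↥_ (ι-mkℚ (ℤ.+ b)))))

  ∑-indicators-zero : ∀ m (b : Fin m → Bool) → ∑ (allFin m) (λ w → [ b w ]) ≡ 0ℚ → ∀ w → b w ≡ false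
  ∑-indicators-zero (suc m) b e = all-false
    where
    tail = ∑ (allFin m) (λ w → [ b (suc w) ])
    split-sum : [ b zero ] + tail ≡ 0ℚ
    split-sum = trans (sym (∑-allFin-suc m (λ w → [ b w ]))) e
    head-false-cases : ∀ x → b zero ≡ x → b zero ≡ false
    head-false-cases false q = q
    head-false-cases true q = ⊥-elim (ℕP.1+n≢0 (toℚ-injective {suc (countᵇ (b ∘ suc) (allFin m))} {0} (trans (toℚ-suc (countᵇ (b ∘ suc) (allFin m))) (trans (cong (1ℚ +_) (toℚ-countᵇ (b ∘ suc) (allFin m))) (trans (cong (λ z → [ z ] + tail) (sym q)) split-sum)))))
    head-false : b zero ≡ false
    head-false = head-false-cases (b zero) refl
    tail-zero : tail ≡ 0ℚ
    tail-zero = trans (sym (+-identityˡ tail)) (trans (cong (λ z → [ z ] + tail) (sym head-false)) split-sum)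
    all-false : ∀ w → b w ≡ false
    all-false zero = head-false
    all-false (suc w) = ∑-indicators-zero m (b ∘ suc) tail-zero w

  distinct-surjective : ∀ k (σ : Vec (Fin k) k) → distinct σ ≡ true → ∀ j → occurs j σ ≡ true
  distinct-surjective k σ e j with occurs j σ in eq
  ... | true = refl
  ... | false = ⊥-elim (true≢false (trans (sym (cong not eq)) (∑-indicators-zero k (λ j → not (occurs j σ)) (trans (count-outside k k σ e) (ℚP.+-inverseʳ (toℚ k))) j)))

  image-sub : ∀ m k (ψ φ : Vec (Fin m) k) → distinct ψ ≡ true → distinct φ ≡ true →
    (∀ w → occurs w ψ ≡ true → occurs w φ ≡ true) → ∀ w → occurs w φ ≡ true → occurs w ψ ≡ true
  image-sub m k ψ φ iψ iφ sub w mφ with occurs w ψ in eq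
  ... | true = refl
  ... | false = ⊥-elim (true≢false (trans (sym (cong₂ (λ x y → x ∧ not y) mφ eq)) (∑-indicators-zero m (λ w → occurs w φ ∧ not (occurs w ψ)) zero-sum w)))
    where
    pt : ∀ w → [ occurs w φ ∧ not (occurs w ψ) ] ≡ [ occurs w φ ] * 1ℚ + - ([ occurs w ψ ] * 1ℚ)
    pt w with occurs w ψ in e1
    ... | true rewrite sub w e1 = refl
    ... | false with occurs w φ
    ... | true = refl
    ... | false = refl
    zero-sum : ∑ (allFin m) (λ w → [ occurs w φ ∧ not (occurs w ψ) ]) ≡ 0ℚ
    zero-sum = begin
      ∑ (allFin m) (λ w → [ occurs w φ ∧ not (occurs w ψ) ]) ≡⟨ ∑-cong (allFin m) pt ⟩
      ∑ (allFin m) (λ w → [ occurs w φ ] * 1ℚ + - ([ occurs w ψ ] * 1ℚ)) ≡⟨ ∑-+ (allFin m) _ _ ⟩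
      ∑ (allFin m) (λ w → [ occurs w φ ] * 1ℚ) + ∑ (allFin m) (λ w → - ([ occurs w ψ ] * 1ℚ)) ≡⟨ cong₂ _+_ (∑-occurs-distinct m k φ (λ _ → 1ℚ) iφ) (trans (∑-neg (allFin m) _) (cong -_ (∑-occurs-distinct m k ψ (λ _ → 1ℚ) iψ))) ⟩
      ∑ (allFin k) (λ _ → 1ℚ) + - ∑ (allFin k) (λ _ → 1ℚ) ≡⟨ ℚP.+-inverseʳ (∑ (allFin k) (λ _ → 1ℚ)) ⟩
      0ℚ ∎

  allV-false-∃ : ∀ {A : Set} (p : A → Bool) {k} (Ψ : Vec A k) → allV p Ψ ≡ false → ∃ λ i → p (lookup Ψ i) ≡ false
  allV-false-∃ p (a ∷ Ψ) e with p a in eq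
  ... | false = zero , eq
  ... | true with allV-false-∃ p Ψ e
  ... | i , q = suc i , q

  beq-refl : ∀ x → beq x x ≡ true
  beq-refl true = refl
  beq-refl false = refl

  δ-images : ∀ m k (φ ψ : Vec (Fin m) k) → distinct φ ≡ true → distinct ψ ≡ true →
    ∏ (allFin m) (λ w → δᵇ (occurs w φ) (occurs w ψ)) ≡ [ allV (λ x → occurs x φ) ψ ]
  δ-images m k φ ψ iφ iψ with allV (λ x → occurs x φ) ψ in eq
  ... | true = ∏-1 (allFin m) _ (λ w → trans (cong₂ (λ x y → δᵇ x y) (eqm w) refl) (cong [_] (beq-refl (occurs w ψ))))
    where
    sub : ∀ w → occurs w ψ ≡ true → occurs w φ ≡ true
    sub w e with occurs⇒∃ w ψ e
    ... | i , q = subst (λ z → occurs z φ ≡ true) q (allV-lookup _ ψ eq i)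
    eqm : ∀ w → occurs w φ ≡ occurs w ψ
    eqm w = bool-ext (image-sub m k ψ φ iψ iφ sub w) (sub w)
  ... | false with allV-false-∃ _ ψ eq
  ... | i , q = ∏-zero m (λ w → δᵇ (occurs w φ) (occurs w ψ)) (lookup ψ i) (cong₂ (λ x y → δᵇ x y) q (occurs-lookup ψ i))

  falling-suc : ∀ c j → falling (toℚ (suc c)) (suc j) ≡ toℚ (suc c) * falling (toℚ c) j
  falling-suc c zero = solve 1 (λ x → (x :- con 0ℚ) :* con 1ℚ := x :* con 1ℚ) refl (toℚ (suc c))
  falling-suc c (suc j) = begin
    (toℚ (suc c) - toℚ (suc j)) * falling (toℚ (suc c)) (suc j) ≡⟨ cong ((toℚ (suc c) - toℚ (suc j)) *_) (falling-suc c j) ⟩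
    (toℚ (suc c) - toℚ (suc j)) * (toℚ (suc c) * falling (toℚ c) j) ≡⟨ cong₂ (λ x y → (x - y) * (x * falling (toℚ c) j)) (toℚ-suc c) (toℚ-suc j) ⟩
    ((1ℚ + toℚ c) - (1ℚ + toℚ j)) * ((1ℚ + toℚ c) * falling (toℚ c) j)
      ≡⟨ solve 3 (λ c j f → ((con 1ℚ :+ c) :- (con 1ℚ :+ j)) :* ((con 1ℚ :+ c) :* f) := (con 1ℚ :+ c) :* ((c :- j) :* f)) refl (toℚ c) (toℚ j) (falling (toℚ c) j) ⟩
    (1ℚ + toℚ c) * ((toℚ c - toℚ j) * falling (toℚ c) j) ≡⟨ cong (_* falling (toℚ c) (suc j)) (sym (toℚ-suc c)) ⟩
    toℚ (suc c) * falling (toℚ c) (suc j) ∎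

  falling-factorial : ∀ k → falling (toℚ k) k ≡ toℚ (k !)
  falling-factorial zero = refl
  falling-factorial (suc k) = trans (falling-suc k k) (trans (cong (toℚ (suc k) *_) (falling-factorial k)) (sym (toℚ-* (suc k) (k !))))

  matchesVia : (J : Graph) → Pattern (size J) → Vec (Fin (size J)) (size J) → Bool
  matchesVia J a σ = allᵇ (λ u → allᵇ (λ v → ⌊ adj J u v ≟ᵇ a (lookup σ u) (lookup σ v) ⌋) (allFin (size J))) (allFin (size J))

  isCopy : (J : Graph) → Pattern (size J) → Bool
  isCopy J a = anyᵇ (λ σ → distinct σ ∧ matchesVia J a σ) (allVecs (allFin (size J)) (size J))

  isCopy-cong : ∀ J {a b} → a ≐ b → isCopy J a ≡ isCopy J b
  isCopy-cong J h = anyᵇ-cong (allVecs (allFin (size J)) (size J)) (λ σ → cong (distinct σ ∧_)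
    (allᵇ-cong (allFin (size J)) (λ u → allᵇ-cong (allFin (size J)) (λ v → cong (λ z → ⌊ adj J u v ≟ᵇ z ⌋) (h (lookup σ u) (lookup σ v))))))

  imageSet : ∀ {m k} → Vec (Fin m) k → Vec Bool m
  imageSet {m} {k} ψ = tabulate (λ w → anyᵇ (λ i → lookup ψ i == w) (allFin k))

  imageSet-lookup : ∀ {m k} (ψ : Vec (Fin m) k) w → lookup (imageSet ψ) w ≡ occurs w ψ
  imageSet-lookup ψ w = trans (VP.lookup∘tabulate _ w) (anyᵇ≡occurs w ψ)

  occurs-intro : ∀ {n k} (Ψ : Vec (Fin n) k) i w → lookup Ψ i ≡ w → occurs w Ψ ≡ true
  occurs-intro Ψ i w e = subst (λ z → occurs z Ψ ≡ true) e (occurs-lookup Ψ i)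

  ∧-intro : ∀ {x y} → x ≡ true → y ≡ true → x ∧ y ≡ true
  ∧-intro refl refl = refl

  isCopy⇒inducedIso : ∀ (J H : Graph) (ψ : Vec (Fin (size H)) (size J)) → distinct ψ ≡ true → isCopy J (adjPattern H ψ) ≡ true → inducedIso J H (imageSet ψ) ≡ true
  isCopy⇒inducedIso J H ψ iψ e with anyᵇ-true _ (allVecs (allFin (size J)) (size J)) e
  ... | σ , eσ = trans (anyᵇ-filter isInjective _ (maps J H))
    (anyᵇ-allVecs-intro (size H) (size J) _ φ (∧-intro injφ (∧-intro himg indφ)))
    where
    k = size J
    m = size H
    φ = V.map (lookup ψ) σ
    lm : ∀ u → lookup φ u ≡ lookup ψ (lookup σ u)
    lm u = VP.lookup-map u (lookup ψ) σ
    injφ : isInjective φ ≡ true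
    injφ = Inj⇒isInjective φ (λ u v q → distinct⇒Inj σ (∧-conicalˡ _ _ eσ) u v (distinct⇒Inj ψ iψ _ _ (trans (sym (lm u)) (trans q (lm v)))))
    sub1 : ∀ w → occurs w φ ≡ true → occurs w ψ ≡ true
    sub1 w q with occurs⇒∃ w φ q
    ... | i , qi = occurs-intro ψ (lookup σ i) w (trans (sym (lm i)) qi)
    sub2 : ∀ w → occurs w ψ ≡ true → occurs w φ ≡ true
    sub2 w q with occurs⇒∃ w ψ q
    ... | j , qj with occurs⇒∃ j σ (distinct-surjective k σ (∧-conicalˡ _ _ eσ) j)
    ... | i , qi = occurs-intro φ i w (trans (lm i) (trans (cong (lookup ψ) qi) qj))
    himg : hasImage φ (imageSet ψ) ≡ true
    himg = allᵇ-intro m _ (λ w → ≟ᵇ-complete (trans (imageSet-lookup ψ w) (trans (bool-ext (sub2 w) (sub1 w)) (sym (anyᵇ≡occurs w φ)))))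
    indφ : isInduced J H φ ≡ true
    indφ = trans (allᵇ-cong (allFin k) (λ u → allᵇ-cong (allFin k) (λ v → cong (λ z → ⌊ adj J u v ≟ᵇ z ⌋) (cong₂ (adj H) (lm u) (lm v))))) (∧-conicalʳ _ _ eσ)

  inducedIso⇒isCopy : ∀ (J H : Graph) (ψ : Vec (Fin (size H)) (size J)) → inducedIso J H (imageSet ψ) ≡ true → isCopy J (adjPattern H ψ) ≡ true
  inducedIso⇒isCopy J H ψ e with anyᵇ-true _ (maps J H) (trans (sym (anyᵇ-filter isInjective _ (maps J H))) e)
  ... | φ , eφ = anyᵇ-allVecs-intro k k _ σv (∧-intro injσ mσ)
    where
    k = size J
    m = size H
    hi : hasImage φ (imageSet ψ) ≡ true
    hi = ∧-conicalˡ (hasImage φ (imageSet ψ)) (isInduced J H φ) (∧-conicalʳ (isInjective φ) _ eφ)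
    inψ : ∀ u → occurs (lookup φ u) ψ ≡ true
    inψ u = trans (sym (imageSet-lookup ψ (lookup φ u))) (trans (≟ᵇ-sound (allᵇ-true m (λ w → ⌊ lookup (imageSet ψ) w ≟ᵇ anyᵇ (λ i → lookup φ i == w) (allFin k) ⌋) hi (lookup φ u))) (trans (anyᵇ≡occurs (lookup φ u) φ) (occurs-lookup φ u)))
    σf : Fin k → Fin k
    σf u = proj₁ (occurs⇒∃ (lookup φ u) ψ (inψ u))
    σψ : ∀ u → lookup ψ (σf u) ≡ lookup φ u
    σψ u = proj₂ (occurs⇒∃ (lookup φ u) ψ (inψ u))
    σv : Vec (Fin k) k
    σv = tabulate σf
    lt : ∀ u → lookup σv u ≡ σf u
    lt u = VP.lookup∘tabulate σf u
    injσ : distinct σv ≡ true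
    injσ = Inj⇒distinct σv (λ u v q → isInjective⇒Inj φ (∧-conicalˡ _ _ eφ) u v (trans (sym (σψ u)) (trans (cong (lookup ψ) (trans (sym (lt u)) (trans q (lt v)))) (σψ v))))
    ind : ∀ u v → adj J u v ≡ adj H (lookup φ u) (lookup φ v)
    ind u v = ≟ᵇ-sound (allᵇ-true k (λ v → ⌊ adj J u v ≟ᵇ adj H (lookup φ u) (lookup φ v) ⌋) (allᵇ-true k (λ u → allᵇ (λ v → ⌊ adj J u v ≟ᵇ adj H (lookup φ u) (lookup φ v) ⌋) (allFin k)) (∧-conicalʳ (hasImage φ (imageSet ψ)) _ (∧-conicalʳ (isInjective φ) _ eφ)) u) v)
    mσ : matchesVia J (adjPattern H ψ) σv ≡ true
    mσ = allᵇ-intro k _ (λ u → allᵇ-intro k _ (λ v → ≟ᵇ-complete (trans (ind u v) (cong₂ (adj H) (trans (sym (σψ u)) (cong (lookup ψ) (sym (lt u)))) (trans (sym (σψ v)) (cong (lookup ψ) (sym (lt v))))))))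

  isCopy≡inducedIso : ∀ (J H : Graph) (ψ : Vec (Fin (size H)) (size J)) → distinct ψ ≡ true → isCopy J (adjPattern H ψ) ≡ inducedIso J H (imageSet ψ)
  isCopy≡inducedIso J H ψ iψ = bool-ext (isCopy⇒inducedIso J H ψ iψ) (inducedIso⇒isCopy J H ψ)

  δˢ : ∀ {m} → Vec Bool m → Vec Bool m → ℚ
  δˢ {m} S c = ∏ (allFin m) (λ w → δᵇ (lookup S w) (lookup c w))

  copy-embeddings : ∀ (J H : Graph) (S : Vec Bool (size H)) → inducedIso J H S ≡ true →
    ∑ (Tuples (size H) (size J)) (λ ψ → [ distinct ψ ] * δˢ S (imageSet ψ)) ≡ toℚ (size J !)
  copy-embeddings J H S e with anyᵇ-true _ (maps J H) (trans (sym (anyᵇ-filter isInjective _ (maps J H))) e)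
  ... | φ , eφ = begin
    ∑ (Tuples m k) (λ ψ → [ distinct ψ ] * δˢ S (imageSet ψ))
      ≡⟨ ∑-cong (Tuples m k) (λ ψ → indicator-cong (distinct ψ) _ _ (λ iψ → trans (∏-cong (allFin m) (λ w → cong₂ δᵇ (hS w) (imageSet-lookup ψ w))) (δ-images m k φ ψ iφ iψ))) ⟩
    ∑ (Tuples m k) (λ ψ → [ distinct ψ ] * [ allV (λ x → occurs x φ) ψ ]) ≡⟨ count-distinct-inside m k (λ x → occurs x φ) ⟩
    falling (∑ (allFin m) (λ w → [ occurs w φ ])) k ≡⟨ cong (λ z → falling z k) (trans (∑-cong (allFin m) (λ w → sym (*-identityʳ [ occurs w φ ]))) (trans (∑-occurs-distinct m k φ (λ _ → 1ℚ) iφ) (∑-ones k))) ⟩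
    falling (toℚ k) k ≡⟨ falling-factorial k ⟩
    toℚ (k !) ∎
    where
    k = size J
    m = size H
    iφ : distinct φ ≡ true
    iφ = trans (sym (isInjective≡distinct φ)) (∧-conicalˡ _ _ eφ)
    hi : hasImage φ S ≡ true
    hi = ∧-conicalˡ (hasImage φ S) (isInduced J H φ) (∧-conicalʳ (isInjective φ) _ eφ)
    hS : ∀ w → lookup S w ≡ occurs w φ
    hS w = trans (≟ᵇ-sound (allᵇ-true m (λ w → ⌊ lookup S w ≟ᵇ anyᵇ (λ i → lookup φ i == w) (allFin k) ⌋) hi w)) (anyᵇ≡occurs w φ)

  s-as-injectiveSum : ∀ (J H : Graph) → toℚ (size J !) * toℚ (s J H) ≡ ∑ (Tuples (size H) (size J)) (λ ψ → [ distinct ψ ] * [ isCopy J (adjPattern H ψ) ])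
  s-as-injectiveSum J H = sym (begin
    ∑ TT (λ ψ → [ distinct ψ ] * [ isCopy J (adjPattern H ψ) ])
      ≡⟨ ∑-cong TT (λ ψ → indicator-cong (distinct ψ) _ _ (λ iψ → cong [_] (isCopy≡inducedIso J H ψ iψ))) ⟩
    ∑ TT (λ ψ → [ distinct ψ ] * [ inducedIso J H (imageSet ψ) ])
      ≡⟨ ∑-cong TT (λ ψ → cong ([ distinct ψ ] *_) (sym (∑-delta-vec bools δᵇ ∑-δᵇ m (imageSet ψ) (λ S → [ inducedIso J H S ])))) ⟩
    ∑ TT (λ ψ → [ distinct ψ ] * ∑ SS (λ S → δˢ S (imageSet ψ) * [ inducedIso J H S ]))
      ≡⟨ ∑-cong TT (λ ψ → trans (∑-*ˡ SS [ distinct ψ ] _) (∑-cong SS (λ S → solve 3 (λ i d c → i :* (d :* c) := c :* (i :* d)) refl [ distinct ψ ] (δˢ S (imageSet ψ)) [ inducedIso J H S ]))) ⟩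
    ∑ TT (λ ψ → ∑ SS (λ S → [ inducedIso J H S ] * ([ distinct ψ ] * δˢ S (imageSet ψ)))) ≡⟨ ∑-swap TT SS _ ⟩
    ∑ SS (λ S → ∑ TT (λ ψ → [ inducedIso J H S ] * ([ distinct ψ ] * δˢ S (imageSet ψ)))) ≡⟨ ∑-cong SS (λ S → sym (∑-*ˡ TT [ inducedIso J H S ] _)) ⟩
    ∑ SS (λ S → [ inducedIso J H S ] * ∑ TT (λ ψ → [ distinct ψ ] * δˢ S (imageSet ψ)))
      ≡⟨ ∑-cong SS (λ S → indicator-cong (inducedIso J H S) _ _ (copy-embeddings J H S)) ⟩
    ∑ SS (λ S → [ inducedIso J H S ] * toℚ (k !)) ≡⟨ sym (∑-*ʳ SS (toℚ (k !)) _) ⟩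
    ∑ SS (λ S → [ inducedIso J H S ]) * toℚ (k !) ≡⟨ cong (_* toℚ (k !)) (sym (toℚ-countᵇ (inducedIso J H) SS)) ⟩
    toℚ (s J H) * toℚ (k !) ≡⟨ *-comm (toℚ (s J H)) (toℚ (k !)) ⟩
    toℚ (k !) * toℚ (s J H) ∎)
    where
    k = size J
    m = size H
    TT = Tuples m k
    SS = allVecs bools m

  lookup-injective : ∀ {A : Set} (xs : List A) → Unique xs → ∀ i j → L.lookup xs i ≡ L.lookup xs j → i ≡ j
  lookup-injective (x ∷ xs) u zero zero e = refl
  lookup-injective (x ∷ xs) (x∉ ∷ u) zero (suc j) e = ⊥-elim (All.lookup x∉ (∈-lookup j) e)
  lookup-injective (x ∷ xs) (x∉ ∷ u) (suc i) zero e = ⊥-elim (All.lookup x∉ (∈-lookup i) (sym e))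
  lookup-injective (x ∷ xs) (x∉ ∷ u) (suc i) (suc j) e = cong suc (lookup-injective xs u i j e)

  map-lookup-allFin : ∀ {A : Set} (xs : List A) → map (L.lookup xs) (allFin (length xs)) ≡ xs
  map-lookup-allFin xs = trans (LP.map-tabulate id (L.lookup xs)) (LP.tabulate-lookup xs)

  distinct-map : ∀ {m n k} (g : Fin m → Fin n) → (∀ a b → g a ≡ g b → a ≡ b) → (ψ : Vec (Fin m) k) → distinct ψ ≡ distinct (V.map g ψ)
  distinct-map g gi ψ = bool-ext (λ e → Inj⇒distinct (V.map g ψ) (λ u v q → distinct⇒Inj ψ e u v (gi _ _ (trans (sym (VP.lookup-map u g ψ)) (trans q (VP.lookup-map v g ψ))))))
    (λ e → Inj⇒distinct ψ (λ u v q → distinct⇒Inj (V.map g ψ) e u v (trans (VP.lookup-map u g ψ) (trans (cong g q) (sym (VP.lookup-map v g ψ))))))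

  injectiveSum-induced : ∀ (J G : Graph) (p : Fin (size G) → Bool) →
    ∑ (Tuples (size (induced G p)) (size J)) (λ ψ → [ distinct ψ ] * [ isCopy J (adjPattern (induced G p) ψ) ]) ≡
    ∑ (Tuples (size G) (size J)) (λ φ → [ allV p φ ] * ([ distinct φ ] * [ isCopy J (adjPattern G φ) ]))
  injectiveSum-induced J G p = begin
    ∑ (Tuples m k) (λ ψ → [ distinct ψ ] * [ isCopy J (adjPattern (induced G p) ψ) ])
      ≡⟨ ∑-cong (Tuples m k) (λ ψ → cong₂ (λ x y → [ x ] * [ y ]) (distinct-map g (lookup-injective vs (Unique.filter⁺ (T? ∘ p) (Unique.allFin⁺ (size G)))) ψ)
           (isCopy-cong J (λ u v → cong₂ (adj G) (sym (VP.lookup-map u g ψ)) (sym (VP.lookup-map v g ψ))))) ⟩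
    ∑ (Tuples m k) (λ ψ → F (V.map g ψ)) ≡⟨ sym (∑-allVecs-map g (allFin m) k F) ⟩
    ∑ (allVecs (map g (allFin m)) k) F ≡⟨ cong (λ l → ∑ (allVecs l k) F) (map-lookup-allFin vs) ⟩
    ∑ (allVecs vs k) F ≡⟨ ∑-allVecs-filter p (allFin (size G)) k F ⟩
    ∑ (Tuples (size G) k) (λ φ → [ allV p φ ] * F φ) ∎
    where
    k = size J
    vs = filterᵇ p (allFin (size G))
    m = length vs
    g = L.lookup vs
    F : Vec (Fin (size G)) k → ℚ
    F φ = [ distinct φ ] * [ isCopy J (adjPattern G φ) ]

  oneFn : ∀ {r} → PatternFn r
  oneFn = record { fn = λ _ _ → 1ℚ ; fn-cong = λ _ _ → refl }

  mulFn : ∀ {r} → PatternFn r → PatternFn r → PatternFn r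
  mulFn P Q = record { fn = λ e a → fn P e a * fn Q e a ; fn-cong = λ ee aa → cong₂ _*_ (fn-cong P ee aa) (fn-cong Q ee aa) }

  embedLeft : ∀ k m → Fin (suc k) → Fin (suc (k ℕ.+ m))
  embedLeft k m zero = zero
  embedLeft k m (suc i) = suc (i ↑ˡ m)

  embedRight : ∀ k m → Fin (suc m) → Fin (suc (k ℕ.+ m))
  embedRight k m zero = zero
  embedRight k m (suc i) = suc (k ↑ʳ i)

  embedLeft-lookup : ∀ {A : Set} {k m} (v : A) (φ1 : Vec A k) (φ2 : Vec A m) x → lookup (v ∷ (φ1 ++ φ2)) (embedLeft k m x) ≡ lookup (v ∷ φ1) x
  embedLeft-lookup v φ1 φ2 zero = refl
  embedLeft-lookup v φ1 φ2 (suc i) = VP.lookup-++ˡ φ1 φ2 i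

  embedRight-lookup : ∀ {A : Set} {k m} (v : A) (φ1 : Vec A k) (φ2 : Vec A m) x → lookup (v ∷ (φ1 ++ φ2)) (embedRight k m x) ≡ lookup (v ∷ φ2) x
  embedRight-lookup v φ1 φ2 zero = refl
  embedRight-lookup v φ1 φ2 (suc i) = VP.lookup-++ʳ φ1 φ2 i

  -- pairFn P Q evaluates P and Q on the two blocks sharing the head v.
  pairFn : ∀ k m → PatternFn (suc k) → PatternFn (suc m) → PatternFn (suc (k ℕ.+ m))
  pairFn k m P Q = mulFn (reindex (embedLeft k m) P) (reindex (embedRight k m) Q)

  pairFn-eval : ∀ k m (P : PatternFn (suc k)) (Q : PatternFn (suc m)) (G : Graph) v (φ1 : Vec (Fin (size G)) k) (φ2 : Vec (Fin (size G)) m) →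
    evalAt (pairFn k m P Q) G (v ∷ (φ1 ++ φ2)) ≡ evalAt P G (v ∷ φ1) * evalAt Q G (v ∷ φ2)
  pairFn-eval k m P Q G v φ1 φ2 = cong₂ _*_ (evalAt-reindex P G (v ∷ φ1) (v ∷ (φ1 ++ φ2)) (embedLeft k m) (embedLeft-lookup v φ1 φ2))
                                         (evalAt-reindex Q G (v ∷ φ2) (v ∷ (φ1 ++ φ2)) (embedRight k m) (embedRight-lookup v φ1 φ2))

  pairFn-sum : ∀ k m (P : PatternFn (suc k)) (Q : PatternFn (suc m)) (G : Graph) v →
    ∑ (Tuples (size G) k) (λ φ → evalAt P G (v ∷ φ)) * ∑ (Tuples (size G) m) (λ φ → evalAt Q G (v ∷ φ)) ≡ ∑ (Tuples (size G) (k ℕ.+ m)) (λ φ → evalAt (pairFn k m P Q) G (v ∷ φ))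
  pairFn-sum k m P Q G v = begin
    ∑ (Tuples n k) (λ φ → evalAt P G (v ∷ φ)) * ∑ (Tuples n m) (λ φ → evalAt Q G (v ∷ φ)) ≡⟨ ∑-*ʳ (Tuples n k) _ _ ⟩
    ∑ (Tuples n k) (λ φ1 → evalAt P G (v ∷ φ1) * ∑ (Tuples n m) (λ φ → evalAt Q G (v ∷ φ))) ≡⟨ ∑-cong (Tuples n k) (λ φ1 → ∑-*ˡ (Tuples n m) (evalAt P G (v ∷ φ1)) _) ⟩
    ∑ (Tuples n k) (λ φ1 → ∑ (Tuples n m) (λ φ2 → evalAt P G (v ∷ φ1) * evalAt Q G (v ∷ φ2))) ≡⟨ ∑-cong (Tuples n k) (λ φ1 → ∑-cong (Tuples n m) (λ φ2 → sym (pairFn-eval k m P Q G v φ1 φ2))) ⟩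
    ∑ (Tuples n k) (λ φ1 → ∑ (Tuples n m) (λ φ2 → evalAt (pairFn k m P Q) G (v ∷ (φ1 ++ φ2)))) ≡⟨ sym (∑-split (allFin n) k m _) ⟩
    ∑ (Tuples n (k ℕ.+ m)) (λ φ → evalAt (pairFn k m P Q) G (v ∷ φ)) ∎
    where n = size G

  -- A side selects vertices w from (w = v, w ~ v): it describes G⁻_v or G⁺_v.
  Side : Set
  Side = Bool → Bool → Bool

  sideGraph : Side → (G : Graph) → Fin (size G) → Graph
  sideGraph c G v = induced G (λ w → c (w == v) (adj G v w))

  distinctᵖ : ∀ {k} → Pattern k → Bool
  distinctᵖ {k} e = allᵇ (λ u → allᵇ (λ v → (u == v) ∨ not (e u v)) (allFin k)) (allFin k)

  dropHead : ∀ {k} → Pattern (suc k) → Pattern k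
  dropHead e x y = e (suc x) (suc y)

  sideCondition : Side → ∀ {k} → Pattern (suc k) → Pattern (suc k) → Bool
  sideCondition c {k} e a = allᵇ (λ i → c (e (suc i) zero) (a zero (suc i))) (allFin k)

  copyFn : Side → (J : Graph) → PatternFn (suc (size J))
  copyFn c J = record
    { fn = λ e a → [ sideCondition c e a ] * ([ distinctᵖ (dropHead e) ] * [ isCopy J (dropHead a) ])
    ; fn-cong = λ {e} {e'} {a} {a'} ee aa → cong₂ (λ x y → [ x ] * y)
        (allᵇ-cong (allFin (size J)) (λ i → cong₂ c (ee (suc i) zero) (aa zero (suc i))))
        (cong₂ (λ x y → [ x ] * [ y ]) (allᵇ-cong (allFin (size J)) (λ u → allᵇ-cong (allFin (size J)) (λ v → cong (λ z → (u == v) ∨ not z) (ee (suc u) (suc v)))))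
          (isCopy-cong J (λ x y → aa (suc x) (suc y)))) }

  allV-allᵇ : ∀ {A : Set} (p : A → Bool) {k} (φ : Vec A k) → allV p φ ≡ allᵇ (λ i → p (lookup φ i)) (allFin k)
  allV-allᵇ p [] = refl
  allV-allᵇ p {suc k} (a ∷ φ) = trans (cong (p a ∧_) (allV-allᵇ p φ)) (sym (allᵇ-suc k (λ i → p (lookup (a ∷ φ) i))))

  s-as-tupleSum : ∀ (c : Side) (J G : Graph) (v : Fin (size G)) →
    toℚ (size J !) * toℚ (s J (sideGraph c G v)) ≡ ∑ (Tuples (size G) (size J)) (λ φ → evalAt (copyFn c J) G (v ∷ φ))
  s-as-tupleSum c J G v = trans (s-as-injectiveSum J (sideGraph c G v)) (trans (injectiveSum-induced J G p) (∑-cong (Tuples (size G) (size J)) (λ φ →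
      cong₂ (λ x y → [ x ] * ([ y ] * [ isCopy J (adjPattern G φ) ])) (allV-allᵇ p φ) (sym (isInjective≡distinct φ)))))
    where p = λ w → c (w == v) (adj G v w)

  totalSize : List Graph → ℕ
  totalSize Js = sumℕ (map size Js)

  copiesFn : Side → (Js : List Graph) → PatternFn (suc (totalSize Js))
  copiesFn c [] = oneFn
  copiesFn c (J ∷ Js) = pairFn (size J) (totalSize Js) (copyFn c J) (copiesFn c Js)

  factorials : List Graph → ℚ
  factorials [] = 1ℚ
  factorials (J ∷ Js) = toℚ (size J !) * factorials Js

  countProduct : List Graph → Graph → ℚ
  countProduct [] H = 1ℚ
  countProduct (J ∷ Js) H = toℚ (s J H) * countProduct Js H

  countProduct-as-tupleSum : ∀ (c : Side) (Js : List Graph) (G : Graph) v →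
    factorials Js * countProduct Js (sideGraph c G v) ≡ ∑ (Tuples (size G) (totalSize Js)) (λ φ → evalAt (copiesFn c Js) G (v ∷ φ))
  countProduct-as-tupleSum c [] G v = sym (∑-allVecs-zero (allFin (size G)) (λ φ → evalAt (copiesFn c []) G (v ∷ φ)))
  countProduct-as-tupleSum c (J ∷ Js) G v = begin
    (toℚ (size J !) * factorials Js) * (toℚ (s J H) * countProduct Js H) ≡⟨ solve 4 (λ a b x y → (a :* b) :* (x :* y) := (a :* x) :* (b :* y)) refl (toℚ (size J !)) (factorials Js) (toℚ (s J H)) (countProduct Js H) ⟩
    (toℚ (size J !) * toℚ (s J H)) * (factorials Js * countProduct Js H) ≡⟨ cong₂ _*_ (s-as-tupleSum c J G v) (countProduct-as-tupleSum c Js G v) ⟩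
    ∑ (Tuples (size G) (size J)) (λ φ → evalAt (copyFn c J) G (v ∷ φ)) * ∑ (Tuples (size G) (totalSize Js)) (λ φ → evalAt (copiesFn c Js) G (v ∷ φ)) ≡⟨ pairFn-sum (size J) (totalSize Js) (copyFn c J) (copiesFn c Js) G v ⟩
    ∑ (Tuples (size G) (totalSize (J ∷ Js))) (λ φ → evalAt (copiesFn c (J ∷ Js)) G (v ∷ φ)) ∎
    where H = sideGraph c G v

  nonNeighbours : Side
  nonNeighbours isV isAdj = not isV ∧ not isAdj

  neighbours : Side
  neighbours isV isAdj = isAdj

  toℚ-sumℕ : ∀ {A : Set} (xs : List A) (f : A → ℕ) → toℚ (sumℕ (map f xs)) ≡ ∑ xs (toℚ ∘ f)
  toℚ-sumℕ [] f = refl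
  toℚ-sumℕ (x ∷ xs) f = trans (toℚ-+ (f x) (sumℕ (map f xs))) (cong (toℚ (f x) +_) (toℚ-sumℕ xs f))

  toℚ-prodℕ : ∀ (Js : List Graph) (H : Graph) → toℚ (prodℕ (map (λ J → s J H) Js)) ≡ countProduct Js H
  toℚ-prodℕ [] H = refl
  toℚ-prodℕ (J ∷ Js) H = trans (toℚ-* (s J H) (prodℕ (map (λ J → s J H) Js))) (cong (toℚ (s J H) *_) (toℚ-prodℕ Js H))

  toℚ-lhs : ∀ (Js Js' : List Graph) (G : Graph) →
    toℚ (lhs Js Js' G) ≡ ∑ (allFin (size G)) (λ v → countProduct Js (sideGraph nonNeighbours G v) * countProduct Js' (sideGraph neighbours G v))
  toℚ-lhs Js Js' G = trans (toℚ-sumℕ (allFin (size G)) (λ v → count⁻ v ℕ.* count⁺ v))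
    (∑-cong (allFin (size G)) (λ v → trans (toℚ-* (count⁻ v) (count⁺ v)) (cong₂ _*_ (toℚ-prodℕ Js (G⁻ G v)) (toℚ-prodℕ Js' (G⁺ G v)))))
    where
    count⁻ count⁺ : Fin (size G) → ℕ
    count⁻ v = prodℕ (map (λ J → s J (G⁻ G v)) Js)
    count⁺ v = prodℕ (map (λ J' → s J' (G⁺ G v)) Js')

  lhsFn : (Js Js' : List Graph) → PatternFn (suc (totalSize Js ℕ.+ totalSize Js'))
  lhsFn Js Js' = pairFn (totalSize Js) (totalSize Js') (copiesFn nonNeighbours Js) (copiesFn neighbours Js')

  lhs-as-tupleSum : ∀ (Js Js' : List Graph) (G : Graph) →
    (factorials Js * factorials Js') * toℚ (lhs Js Js' G) ≡ ∑ (Tuples (size G) (suc (totalSize Js ℕ.+ totalSize Js'))) (evalAt (lhsFn Js Js') G)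
  lhs-as-tupleSum Js Js' G = begin
    (factorials Js * factorials Js') * toℚ (lhs Js Js' G) ≡⟨ cong ((factorials Js * factorials Js') *_) (toℚ-lhs Js Js' G) ⟩
    (factorials Js * factorials Js') * ∑ (allFin n) (λ v → countProduct Js (H⁻ v) * countProduct Js' (H⁺ v)) ≡⟨ ∑-*ˡ (allFin n) (factorials Js * factorials Js') _ ⟩
    ∑ (allFin n) (λ v → (factorials Js * factorials Js') * (countProduct Js (H⁻ v) * countProduct Js' (H⁺ v)))
      ≡⟨ ∑-cong (allFin n) (λ v → solve 4 (λ a b x y → (a :* b) :* (x :* y) := (a :* x) :* (b :* y)) refl (factorials Js) (factorials Js') (countProduct Js (H⁻ v)) (countProduct Js' (H⁺ v))) ⟩
    ∑ (allFin n) (λ v → (factorials Js * countProduct Js (H⁻ v)) * (factorials Js' * countProduct Js' (H⁺ v)))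
      ≡⟨ ∑-cong (allFin n) (λ v → trans (cong₂ _*_ (countProduct-as-tupleSum nonNeighbours Js G v) (countProduct-as-tupleSum neighbours Js' G v))
                                         (pairFn-sum (totalSize Js) (totalSize Js') (copiesFn nonNeighbours Js) (copiesFn neighbours Js') G v)) ⟩
    ∑ (allFin n) (λ v → ∑ (Tuples n (totalSize Js ℕ.+ totalSize Js')) (λ φ → evalAt (lhsFn Js Js') G (v ∷ φ))) ≡⟨ sym (∑-allVecs-suc (allFin n) (totalSize Js ℕ.+ totalSize Js') (evalAt (lhsFn Js Js') G)) ⟩
    ∑ (Tuples n (suc (totalSize Js ℕ.+ totalSize Js'))) (evalAt (lhsFn Js Js') G) ∎
    where
    n = size G
    H⁻ H⁺ : Fin n → Graph
    H⁻ = sideGraph nonNeighbours G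
    H⁺ = sideGraph neighbours G

  factorialsℕ : List Graph → ℕ
  factorialsℕ [] = 1
  factorialsℕ (J ∷ Js) = size J ! ℕ.* factorialsℕ Js

  factorials≡ : ∀ Js → factorials Js ≡ toℚ (factorialsℕ Js)
  factorials≡ [] = refl
  factorials≡ (J ∷ Js) = trans (cong (toℚ (size J !) *_) (factorials≡ Js)) (sym (toℚ-* (size J !) (factorialsℕ Js)))

  factorialsℕ-nonZero : ∀ Js → ℕ.NonZero (factorialsℕ Js)
  factorialsℕ-nonZero [] = _
  factorialsℕ-nonZero (J ∷ Js) = ℕP.m*n≢0 (size J !) (factorialsℕ Js) {{size J ℕP.!≢0}} {{factorialsℕ-nonZero Js}}

  toℚ-invertible : ∀ m .{{_ : ℕ.NonZero m}} → Σ ℚ λ q → q * toℚ m ≡ 1ℚ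
  toℚ-invertible (suc a) = ℚ.1/ p , trans (cong (ℚ.1/ p *_) (ι-mkℚ (ℤ.+ suc a))) (ℚP.*-inverseˡ p)
    where p = mkℚ (ℤ.+ suc a) 0 (coprime-1 (suc a))

  factorials-invertible : ∀ (Js Js' : List Graph) → Σ ℚ λ q → q * (factorials Js * factorials Js') ≡ 1ℚ
  factorials-invertible Js Js' = proj₁ inverse , trans (cong (proj₁ inverse *_) N≡) (proj₂ inverse)
    where
    N = factorialsℕ Js ℕ.* factorialsℕ Js'
    inverse = toℚ-invertible N {{ℕP.m*n≢0 (factorialsℕ Js) (factorialsℕ Js') {{factorialsℕ-nonZero Js}} {{factorialsℕ-nonZero Js'}}}}
    N≡ : factorials Js * factorials Js' ≡ toℚ N
    N≡ = trans (cong₂ _*_ (factorials≡ Js) (factorials≡ Js')) (sym (toℚ-* (factorialsℕ Js) (factorialsℕ Js')))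

  cancelˡ : ∀ {q c x y : ℚ} → q * c ≡ 1ℚ → c * x ≡ y → q * y ≡ x
  cancelˡ {q} {c} {x} {y} q*c≡1 c*x≡y = begin
    q * y ≡⟨ cong (q *_) (sym c*x≡y) ⟩
    q * (c * x) ≡⟨ sym (*-assoc q c x) ⟩
    (q * c) * x ≡⟨ cong (_* x) q*c≡1 ⟩
    1ℚ * x ≡⟨ *-identityˡ x ⟩
    x ∎

  factorialsInverse : (Js Js' : List Graph) → ℚ
  factorialsInverse Js Js' = proj₁ (factorials-invertible Js Js')

  lhs-recovered : ∀ (Js Js' : List Graph) (G : Graph) →
    factorialsInverse Js Js' * ∑ (Tuples (size G) (suc (totalSize Js ℕ.+ totalSize Js'))) (evalAt (lhsFn Js Js') G) ≡ toℚ (lhs Js Js' G)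
  lhs-recovered Js Js' G =
    cancelˡ {q = factorialsInverse Js Js'} {c = factorials Js * factorials Js'} {x = toℚ (lhs Js Js' G)} (proj₂ (factorials-invertible Js Js')) (lhs-as-tupleSum Js Js' G)

open import Defs
open import Data.Nat using (ℕ; _+_)
open import Data.List using (List; map)
open import Data.List.Relation.Unary.All using (All)
open import Data.Product using (∃-syntax; _×_; _,_; proj₁; proj₂)
open import Relation.Binary.PropositionalEquality using (_≡_)
open Proof using (lhsFn; tupleSum-expressible; factorialsInverse; lhs-recovered; expr-scale; expr-cong)

mainTheorem12 : (Js Js' : List Graph) →
    ∃[ 𝒥 ] ( All (λ Jm → NoIsolatedVertices (proj₁ Jm)
    × DegBound (size (proj₁ Jm)) (proj₂ Jm)
    (1 + sumℕ (map size Js) + sumℕ (map size Js'))) 𝒥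
    × ((G : Graph) → toℚ (lhs Js Js' G) ≡ rhs 𝒥 G) )
mainTheorem12 Js Js' =
  expr-cong (lhs-recovered Js Js') (expr-scale (factorialsInverse Js Js') (tupleSum-expressible _ (lhsFn Js Js')))
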